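{- For every positive integer $n$, the following identity holds in $\mathbb{Z}[[z_0,\ldots,z_n]]$: \[ \sum_{k \ge 0 } \prod_{j=1}^n [k+1]_{ z_j } z_0^k \ = \ \sum_{\pi\in S_n} \sum_{(\rho,\epsilon)\in I_{2,n}} \frac{\displaystyle \prod_{j\in \mathrm{Des}(\pi)} z_0z_{\pi(1)}z_{\pi(2)}\cdots z_{\pi(j)} \prod_{j\in \mathrm{NNeg}((\rho,\epsilon)^{ -1})} z_0z_{\pi(1)}z_{\pi(2)}\cdots z_{\pi(j)} }{\displaystyle (1-z_0)\prod_{j=1}^n \left(1-z_0^2z_{\pi(1)}^2\cdots z_{\pi(j)}^2 \right) } \, . \]
   Context: $[m]_z=1+z+\cdots+z^{m-1}$; $\mathrm{Des}(\pi)=\{j\in[n-1]:\pi(j)>\pi(j+1)\}$ for $\pi\in S_n$. The hyperoctahedral group $B_n$ consists of signed permutations $(\pi,\epsilon)$ with $\pi\in S_n$, $\epsilon\in\{\pm1\}^n$, identified with the $n\times n$ matrix with entry $\epsilon_i$ at position $(\pi(i),i)$ and zeros elsewhere; the group operation is matrix multiplication. Write $(\pi,\epsilon)$ in window notation $[\epsilon_1\pi(1)\cdots\epsilon_n\pi(n)]$, and identify $\pi\in S_n$ with $(\pi,(1,\ldots,1))$. Order $[-n,n]\setminus\{0\}$ by $-1<-2<\cdots<-n<1<2<\cdots<n$. $I_{2,n}$ is the set of $(\rho,\epsilon)\in B_n$ with $\epsilon_i\rho(i)<\epsilon_{i+1}\rho(i+1)$ in this order for all $i\in[n-1]$. $\mathrm{NNeg}((\rho,\epsilon)^{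 -1})$ is the set $\{\rho(i):\epsilon_i=-1\}$ (equivalently, the set of $j$ such that $(\rho,\epsilon)^{ -1}$ has a negative sign in position $j$ of its window). -}

module Defs where

open import Data.Bool using (Bool; true; false; if_then_else_; _∧_; _∨_)
open import Data.Nat as ℕ using (ℕ; zero; suc; _+_; _*_; _∸_; _≡ᵇ_; _<ᵇ_)
open import Data.Integer as ℤ using (ℤ; +_)
open import Data.Fin using (Fin; zero; suc; toℕ)
open import Data.List using (List; []; _∷_; _++_; map; concatMap; foldr; upTo; allFin; take; zip)
open import Data.Product using (_×_; _,_; proj₁; proj₂)

-- Multivariate formal power series over ℤ in m variables z_0 … z_{m-1}
-- An exponent vector is a function Fin m → ℕ; a series is its
-- coefficient function.

Exp : ℕ → Set
Exp m = Fin m → ℕ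

PS : ℕ → Set
PS m = Exp m → ℤ

sumℕ : List ℕ → ℕ
sumℕ = foldr _+_ 0

sumℤ : List ℤ → ℤ
sumℤ = foldr ℤ._+_ (+ 0)

deg : ∀ {m} → Exp m → ℕ
deg {m} a = sumℕ (map a (allFin m))

eqExp : ∀ {m} → Exp m → Exp m → Bool
eqExp {m} e a = foldr (λ i b → (e i ≡ᵇ a i) ∧ b) true (allFin m)

zeroExp : ∀ {m} → Exp m
zeroExp _ = 0

addExp : ∀ {m} → Exp m → Exp m → Exp m
addExp e f i = e i + f i

sumExp : ∀ {m} → List (Exp m) → Exp m
sumExp = foldr addExp zeroExp

scale : ∀ {m} → ℕ → Exp m → Exp m
scale k e i = k * e i

unit : ∀ {m} → Fin m → Exp m
unit zero zero = 1
unit zero (suc j) = 0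
unit (suc i) zero = 0
unit (suc i) (suc j) = unit i j

cons : ∀ {m} → ℕ → Exp m → Exp (suc m)
cons x f zero = x
cons x f (suc i) = f i

below : ∀ m → Exp m → List (Exp m)
below zero a = (λ ()) ∷ []
below (suc m) a =
  concatMap (λ b0 → map (cons b0) (below m (λ i → a (suc i)))) (upTo (suc (a zero)))

mono : ∀ {m} → Exp m → PS m
mono e a = if eqExp e a then + 1 else + 0

onePS : ∀ {m} → PS m
onePS = mono zeroExp

zeroPS : ∀ {m} → PS m
zeroPS _ = + 0

_⊕_ : ∀ {m} → PS m → PS m → PS m
(f ⊕ g) a = f a ℤ.+ g a

_⊛_ : ∀ {m} → PS m → PS m → PS m
_⊛_ {m} f g a = sumℤ (map (λ b → f b ℤ.* g (λ i → a i ∸ b i)) (below m a))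

infixl 6 _⊕_
infixl 7 _⊛_

ΣL : ∀ {m} → List (PS m) → PS m
ΣL = foldr _⊕_ zeroPS

ΠL : ∀ {m} → List (PS m) → PS m
ΠL = foldr _⊛_ onePS

-- 1 / (1 - z^e) = Σ_{k ≥ 0} z^{k e}, for e ≠ 0.  Since e ≠ 0, only
-- k ≤ deg a can contribute to the coefficient of z^a.
geom : ∀ {m} → Exp m → PS m
geom e a = sumℤ (map (λ k → mono (scale k e) a) (upTo (suc (deg a))))

-- Σ_{k ≥ 0} f k, for a family where every monomial of f k has total
-- degree ≥ k (so the sum is locally finite): coefficient of z^a is
-- Σ_{k ≤ deg a} [z^a] f k.
Σ∞ : ∀ {m} → (ℕ → PS m) → PS m
Σ∞ f a = sumℤ (map (λ k → f k a) (upTo (suc (deg a))))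

qint : ∀ {m} → ℕ → Fin m → PS m
qint r i = ΣL (map (λ s → mono (scale s (unit i))) (upTo r))

-- Permutations in window notation (lists of values in 1..n)

ins : ℕ → List ℕ → List (List ℕ)
ins x [] = (x ∷ []) ∷ []
ins x (y ∷ ys) = (x ∷ y ∷ ys) ∷ map (y ∷_) (ins x ys)

perms : ℕ → List (List ℕ)
perms zero = [] ∷ []
perms (suc n) = concatMap (ins (suc n)) (perms n)

-- all sign vectors of length n (true = sign -1)
signs : ℕ → List (List Bool)
signs zero = [] ∷ []
signs (suc n) = concatMap (λ s → (true ∷ s) ∷ (false ∷ s) ∷ []) (signs n)

-- a signed permutation (ρ, ε) in window notation: list of pairs
-- (ε_i = -1 ?, ρ(i))
SignedPerm : Set
SignedPerm = List (Bool × ℕ)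

signedPerms : ℕ → List SignedPerm
signedPerms n = concatMap (λ ρ → map (λ ε → zip ε ρ) (signs n)) (perms n)

-- order -1 < -2 < … < -n < 1 < … < n, via a rank function
key : ℕ → Bool × ℕ → ℕ
key n (true , i) = i
key n (false , i) = n + i

increasing : ℕ → SignedPerm → Bool
increasing n (x ∷ y ∷ w) = (key n x <ᵇ key n y) ∧ increasing n (y ∷ w)
increasing n _ = true

filterᵇ' : ∀ {A : Set} → (A → Bool) → List A → List A
filterᵇ' p [] = []
filterᵇ' p (x ∷ xs) = if p x then x ∷ filterᵇ' p xs else filterᵇ' p xs

I2 : ℕ → List SignedPerm
I2 n = filterᵇ' (increasing n) (signedPerms n)

-- NNeg((ρ,ε)^{-1}) = { ρ(i) : ε_i = -1 }
NNeg : SignedPerm → List ℕ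
NNeg w = map proj₂ (filterᵇ' proj₁ w)

desAux : ℕ → List ℕ → List ℕ
desAux j (x ∷ y ∷ r) = (if y <ᵇ x then j ∷ [] else []) ++ desAux (suc j) (y ∷ r)
desAux j _ = []

Des : List ℕ → List ℕ
Des = desAux 1

memᵇ : ℕ → List ℕ → Bool
memᵇ x = foldr (λ y b → (x ≡ᵇ y) ∨ b) false

-- exponent vector of z_0 z_{π(1)} ⋯ z_{π(j)} in variables z_0 … z_n
-- (index zero is z_0, index suc i is z_{i+1})
uExp : (n : ℕ) → List ℕ → ℕ → Exp (suc n)
uExp n π j zero = 1
uExp n π j (suc i) = if memᵇ (suc (toℕ i)) (take j π) then 1 else 0

LHS : (n : ℕ) → PS (suc n)
LHS n = Σ∞ (λ k → ΠL (map (λ j → qint (suc k) (suc j)) (allFin n)) ⊛ mono (scale k (unit zero)))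

term : (n : ℕ) → List ℕ → SignedPerm → PS (suc n)
term n π w =
  mono (sumExp (map (uExp n π) (Des π)))
  ⊛ mono (sumExp (map (uExp n π) (NNeg w)))
  ⊛ geom (unit zero)
  ⊛ ΠL (map (λ j → geom (scale 2 (uExp n π j))) (map suc (upTo n)))

RHS : (n : ℕ) → PS (suc n)
RHS n = ΣL (concatMap (λ π → map (term n π) (I2 n)) (perms n))

-- Compare coefficients of z^a.  On the left the coefficient is 1 when
-- a_j ≤ a_0 for all j and 0 otherwise.  On the right, read a along π as the
-- sequence a_0, a_{π(1)}, …, a_{π(n)}, 0; the monomial z_0 z_{π(1)} ⋯ z_{π(j)}
-- then becomes the indicator of [0, j], so the summand of (π, (ρ,ε)) has
-- coefficient 1 exactly when this sequence drops by at least
-- [j ∈ Des π] + [j ∈ NNeg] at every j, with even excess for j ≥ 1.  This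
-- forces π to list the variables by decreasing exponent, ties broken
-- increasingly, which singles out one π and requires a_j ≤ a_0; it forces NNeg
-- to be the set of positions with odd excess, and among all ρ exactly one
-- ordering with these signs lies in I_{2,n}.

module Submission where

open import Algebra.Properties.CommutativeSemigroup as CommutativeSemigroupProperties using ()
open import Data.Bool using (Bool; true; false; if_then_else_; _∧_)
open import Data.Bool.Properties using (T-≡)
open import Data.Empty using (⊥; ⊥-elim)
open import Data.Fin using (Fin; zero; suc; toℕ; fromℕ<)
import Data.Fin.Properties as FP
open import Data.Integer using (ℤ; 0ℤ; 1ℤ) renaming (_+_ to _+ℤ_; _*_ to _*ℤ_)
import Data.Integer.Properties as ZP
open import Data.List using (List; []; _∷_; _++_; map; concatMap; foldr; upTo; allFin; take; zip; applyUpTo; tabulate; length)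
import Data.List.Properties as LP
open import Data.List.Membership.Propositional using (_∈_; find; lose)
open import Data.List.Membership.Propositional.Properties
  using (∈-tabulate⁺; ∈-tabulate⁻; ∈-map⁺; ∈-map⁻; ∈-concatMap⁺; ∈-concatMap⁻; ∈-++⁻)
open import Data.List.Relation.Unary.All using (All; []; _∷_)
open import Data.List.Relation.Unary.Any using (here; there)
open import Data.Nat using (ℕ; zero; suc; _+_; _*_; _∸_; _≡ᵇ_; _<ᵇ_; _≤ᵇ_; _≤_; _<_; z≤n; s≤s; _≤?_; _<?_)
import Data.Nat.Properties as NP
open import Data.Nat.Tactic.RingSolver using (solve-∀)
open import Data.Product using (_×_; _,_; proj₁; proj₂; ∃)
open import Data.Sum using (_⊎_; inj₁; inj₂)
open import Function using (_∘_; id)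
open import Function.Bundles using (Equivalence; _⇔_; mk⇔)
open import Relation.Binary.Definitions using (tri<; tri≈; tri>)
open import Relation.Binary.PropositionalEquality
open import Relation.Nullary using (¬_; Dec; yes; no)

open import Defs

open CommutativeSemigroupProperties NP.+-commutativeSemigroup using () renaming (interchange to +-interchange)
open CommutativeSemigroupProperties ZP.+-commutativeSemigroup using () renaming (interchange to +ℤ-interchange)

indicator : Bool → ℤ
indicator b = if b then 1ℤ else 0ℤ

true≢false : {b : Bool} → b ≡ true → b ≡ false → ⊥
true≢false refl ()

≢true⇒≡false : ∀ {b} → ¬ (b ≡ true) → b ≡ false
≢true⇒≡false {true} h = ⊥-elim (h refl)
≢true⇒≡false {false} h = refl

∧-true₁ : ∀ {a b} → (a ∧ b) ≡ true → a ≡ true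
∧-true₁ {true} e = refl

∧-true₂ : ∀ {a b} → (a ∧ b) ≡ true → b ≡ true
∧-true₂ {true} e = e

∧-intro : ∀ {a b} → a ≡ true → b ≡ true → (a ∧ b) ≡ true
∧-intro refl refl = refl

≡ᵇ-sound : ∀ {m n} → (m ≡ᵇ n) ≡ true → m ≡ n
≡ᵇ-sound {m} {n} e = NP.≡ᵇ⇒≡ m n (Equivalence.from T-≡ e)

≡ᵇ-refl : ∀ m → (m ≡ᵇ m) ≡ true
≡ᵇ-refl zero = refl
≡ᵇ-refl (suc m) = ≡ᵇ-refl m

≡ᵇ-false : ∀ {x y} → x ≢ y → (x ≡ᵇ y) ≡ false
≡ᵇ-false ne = ≢true⇒≡false (ne ∘ ≡ᵇ-sound)

≤ᵇ-sound : ∀ {m n} → (m ≤ᵇ n) ≡ true → m ≤ n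
≤ᵇ-sound {m} {n} h = NP.≤ᵇ⇒≤ m n (Equivalence.from T-≡ h)

≤ᵇ-complete : ∀ {m n} → m ≤ n → (m ≤ᵇ n) ≡ true
≤ᵇ-complete le = Equivalence.to T-≡ (NP.≤⇒≤ᵇ le)

<ᵇ-sound : ∀ {m n} → (m <ᵇ n) ≡ true → m < n
<ᵇ-sound {m} {n} h = NP.<ᵇ⇒< m n (Equivalence.from T-≡ h)

<ᵇ-complete : ∀ {m n} → m < n → (m <ᵇ n) ≡ true
<ᵇ-complete lt = Equivalence.to T-≡ (NP.<⇒<ᵇ lt)

<ᵇ-false : ∀ {m n} → ¬ (m < n) → (m <ᵇ n) ≡ false
<ᵇ-false nlt = ≢true⇒≡false (nlt ∘ <ᵇ-sound)

≤ᵇ-suc : ∀ e t → (e <ᵇ suc t) ≡ (e ≤ᵇ t)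
≤ᵇ-suc zero t = refl
≤ᵇ-suc (suc e) t = refl

Σ< : ℕ → (ℕ → ℤ) → ℤ
Σ< zero G = 0ℤ
Σ< (suc N) G = G 0 +ℤ Σ< N (G ∘ suc)

Σ<-cong : ∀ N {G H : ℕ → ℤ} → (∀ t → t < N → G t ≡ H t) → Σ< N G ≡ Σ< N H
Σ<-cong zero h = refl
Σ<-cong (suc N) h = cong₂ _+ℤ_ (h 0 (s≤s z≤n)) (Σ<-cong N (λ t lt → h (suc t) (s≤s lt)))

Σ<-zero : ∀ N {G : ℕ → ℤ} → (∀ t → t < N → G t ≡ 0ℤ) → Σ< N G ≡ 0ℤ
Σ<-zero zero h = refl
Σ<-zero (suc N) h = cong₂ _+ℤ_ (h 0 (s≤s z≤n)) (Σ<-zero N (λ t lt → h (suc t) (s≤s lt)))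

Σ<-single : ∀ N {G : ℕ → ℤ} t₀ → t₀ < N → (∀ t → t < N → t ≢ t₀ → G t ≡ 0ℤ) → Σ< N G ≡ G t₀
Σ<-single (suc N) {G} zero lt h =
  trans (cong (G 0 +ℤ_) (Σ<-zero N (λ t lt′ → h (suc t) (s≤s lt′) (λ ())))) (ZP.+-identityʳ (G 0))
Σ<-single (suc N) {G} (suc t₀) (s≤s lt) h =
  trans (cong₂ _+ℤ_ (h 0 (s≤s z≤n) (λ ())) (Σ<-single N t₀ lt (λ t lt′ ne → h (suc t) (s≤s lt′) (ne ∘ NP.suc-injective))))
        (ZP.+-identityˡ _)

Σ<-shift : ∀ A e (X : ℕ → ℤ) →
  Σ< (suc A) (λ t → if e ≤ᵇ t then X (t ∸ e) else 0ℤ) ≡ (if e ≤ᵇ A then Σ< (suc (A ∸ e)) X else 0ℤ)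
Σ<-shift A zero X = refl
Σ<-shift zero (suc e) X = refl
Σ<-shift (suc A) (suc e) X = trans (ZP.+-identityˡ _) (trans
  (Σ<-cong (suc A) (λ t _ → cong (λ c → if c then X (t ∸ e) else 0ℤ) (≤ᵇ-suc e t)))
  (trans (Σ<-shift A e X) (cong (λ c → if c then Σ< (suc (A ∸ e)) X else 0ℤ) (sym (≤ᵇ-suc e A)))))

sum-applyUpTo : ∀ N (G : ℕ → ℤ) (f : ℕ → ℕ) → sumℤ (map G (applyUpTo f N)) ≡ Σ< N (G ∘ f)
sum-applyUpTo zero G f = refl
sum-applyUpTo (suc N) G f = cong (G (f 0) +ℤ_) (sum-applyUpTo N G (f ∘ suc))

sum-upTo : ∀ N (G : ℕ → ℤ) → sumℤ (map G (upTo N)) ≡ Σ< N G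
sum-upTo N G = sum-applyUpTo N G id

sum-++ : ∀ {A : Set} (F : A → ℤ) xs ys → sumℤ (map F (xs ++ ys)) ≡ sumℤ (map F xs) +ℤ sumℤ (map F ys)
sum-++ F [] ys = sym (ZP.+-identityˡ _)
sum-++ F (x ∷ xs) ys = trans (cong (F x +ℤ_) (sum-++ F xs ys)) (sym (ZP.+-assoc (F x) _ _))

sum-concatMap : ∀ {A B : Set} (F : B → ℤ) (g : A → List B) xs →
  sumℤ (map F (concatMap g xs)) ≡ sumℤ (map (λ x → sumℤ (map F (g x))) xs)
sum-concatMap F g [] = refl
sum-concatMap F g (x ∷ xs) =
  trans (sum-++ F (g x) (concatMap g xs)) (cong (sumℤ (map F (g x)) +ℤ_) (sum-concatMap F g xs))

sum-map-map : ∀ {A B : Set} (F : B → ℤ) (g : A → B) xs → sumℤ (map F (map g xs)) ≡ sumℤ (map (F ∘ g) xs)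
sum-map-map F g xs = cong sumℤ (sym (LP.map-∘ xs))

sum-cong : ∀ {A : Set} {F G : A → ℤ} xs → (∀ x → F x ≡ G x) → sumℤ (map F xs) ≡ sumℤ (map G xs)
sum-cong xs h = cong sumℤ (LP.map-cong h xs)

sum-zero-∈ : ∀ {A : Set} {F : A → ℤ} xs → (∀ x → x ∈ xs → F x ≡ 0ℤ) → sumℤ (map F xs) ≡ 0ℤ
sum-zero-∈ [] h = refl
sum-zero-∈ (x ∷ xs) h = cong₂ _+ℤ_ (h x (here refl)) (sum-zero-∈ xs (λ y p → h y (there p)))

sum-zero : ∀ {A : Set} {F : A → ℤ} xs → (∀ x → F x ≡ 0ℤ) → sumℤ (map F xs) ≡ 0ℤ
sum-zero xs h = sum-zero-∈ xs (λ x _ → h x)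

sum-distribʳ : ∀ {A : Set} (F : A → ℤ) (c : ℤ) xs → sumℤ (map F xs) *ℤ c ≡ sumℤ (map (λ x → F x *ℤ c) xs)
sum-distribʳ F c [] = refl
sum-distribʳ F c (x ∷ xs) = trans (ZP.*-distribʳ-+ c (F x) _) (cong (F x *ℤ c +ℤ_) (sum-distribʳ F c xs))

sum-+ : ∀ {A : Set} (F G : A → ℤ) xs → sumℤ (map (λ x → F x +ℤ G x) xs) ≡ sumℤ (map F xs) +ℤ sumℤ (map G xs)
sum-+ F G [] = refl
sum-+ F G (x ∷ xs) = trans (cong (F x +ℤ G x +ℤ_) (sum-+ F G xs)) (+ℤ-interchange (F x) (G x) _ _)

sum-swap : ∀ {A B : Set} (H : A → B → ℤ) (as : List A) (bs : List B) →
  sumℤ (map (λ b → sumℤ (map (λ a → H a b) as)) bs) ≡ sumℤ (map (λ a → sumℤ (map (λ b → H a b) bs)) as)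
sum-swap H [] bs = sum-zero bs (λ _ → refl)
sum-swap H (a ∷ as) bs =
  trans (sum-+ (H a) (λ b → sumℤ (map (λ a → H a b) as)) bs) (cong (sumℤ (map (H a) bs) +ℤ_) (sum-swap H as bs))

sum-filter : ∀ {A : Set} (p : A → Bool) (F : A → ℤ) xs →
  sumℤ (map F (filterᵇ' p xs)) ≡ sumℤ (map (λ w → if p w then F w else 0ℤ) xs)
sum-filter p F [] = refl
sum-filter p F (x ∷ xs) with p x
... | true = cong (F x +ℤ_) (sum-filter p F xs)
... | false = trans (sum-filter p F xs) (sym (ZP.+-identityˡ _))

if-zero : ∀ (c : Bool) {x : ℤ} → x ≡ 0ℤ → (if c then x else 0ℤ) ≡ 0ℤ
if-zero true h = h
if-zero false h = refl

-- Exponent vectors are functions, so without function extensionality every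
-- coefficient function has to be shown to respect pointwise equality.
Extensional : ∀ {m} → (Exp m → ℤ) → Set
Extensional f = ∀ {x y} → x ≗ y → f x ≡ f y

tailExp : ∀ {m} → Exp (suc m) → Exp m
tailExp a i = a (suc i)

_≤ₑ_ : ∀ {m} → Exp m → Exp m → Set
e ≤ₑ a = ∀ i → e i ≤ a i

_≤ₑ?_ : ∀ {m} (e a : Exp m) → Dec (e ≤ₑ a)
e ≤ₑ? a = FP.all? (λ i → e i ≤? a i)

_∸ₑ_ : ∀ {m} → Exp m → Exp m → Exp m
(a ∸ₑ b) i = a i ∸ b i

eqExpOn : ∀ {k m} (e a : Exp m) (f : Fin k → Fin m) → Bool
eqExpOn e a f = foldr (λ i b → (e i ≡ᵇ a i) ∧ b) true (tabulate f)

eqExpOn-sound : ∀ {k m} (e a : Exp m) (f : Fin k → Fin m) → eqExpOn e a f ≡ true → ∀ j → e (f j) ≡ a (f j)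
eqExpOn-sound {suc k} e a f h zero = ≡ᵇ-sound (∧-true₁ {e (f zero) ≡ᵇ a (f zero)} h)
eqExpOn-sound {suc k} e a f h (suc j) = eqExpOn-sound e a (f ∘ suc) (∧-true₂ {e (f zero) ≡ᵇ a (f zero)} h) j

eqExpOn-complete : ∀ {k m} (e a : Exp m) (f : Fin k → Fin m) → (∀ j → e (f j) ≡ a (f j)) → eqExpOn e a f ≡ true
eqExpOn-complete {zero} e a f h = refl
eqExpOn-complete {suc k} e a f h rewrite h zero | ≡ᵇ-refl (a (f zero)) = eqExpOn-complete e a (f ∘ suc) (h ∘ suc)

eqExp-sound : ∀ {m} {e a : Exp m} → eqExp e a ≡ true → e ≗ a
eqExp-sound {e = e} {a} = eqExpOn-sound e a id

eqExp-complete : ∀ {m} {e a : Exp m} → e ≗ a → eqExp e a ≡ true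
eqExp-complete {e = e} {a} = eqExpOn-complete e a id

eqExp-iff : ∀ {m k} {e a : Exp m} {e′ a′ : Exp k} → (e ≗ a → e′ ≗ a′) → (e′ ≗ a′ → e ≗ a) → eqExp e a ≡ eqExp e′ a′
eqExp-iff {e = e} {a} {e′} {a′} f g with eqExp e a in eq₁ | eqExp e′ a′ in eq₂
... | true | true = refl
... | false | false = refl
... | true | false = ⊥-elim (true≢false (eqExp-complete {e = e′} {a′} (f (eqExp-sound eq₁))) eq₂)
... | false | true = ⊥-elim (true≢false (eqExp-complete {e = e} {a} (g (eqExp-sound eq₂))) eq₁)

mono-ext : ∀ {m} (e : Exp m) → Extensional (mono e)
mono-ext e {x} {y} h =
  cong indicator (eqExp-iff {e = e} {x} {e} {y} (λ p i → trans (p i) (h i)) (λ p i → trans (p i) (sym (h i))))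

mono-hit : ∀ {m} {e a : Exp m} → e ≗ a → mono e a ≡ 1ℤ
mono-hit h rewrite eqExp-complete h = refl

mono-miss : ∀ {m} {e a : Exp m} → ¬ (e ≗ a) → mono e a ≡ 0ℤ
mono-miss {e = e} {a} ne with eqExp e a in eq
... | true = ⊥-elim (ne (eqExp-sound eq))
... | false = refl

cons-tailExp : ∀ {m} (c : Exp (suc m)) → cons (c zero) (tailExp c) ≗ c
cons-tailExp c zero = refl
cons-tailExp c (suc i) = refl

below-cong : ∀ m {x y : Exp m} → x ≗ y → below m x ≡ below m y
below-cong zero h = refl
below-cong (suc m) {x} {y} h rewrite h zero | below-cong m {tailExp x} {tailExp y} (h ∘ suc) = refl

sum-below : ∀ m (a : Exp (suc m)) (F : Exp (suc m) → ℤ) →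
  sumℤ (map F (below (suc m) a)) ≡ Σ< (suc (a zero)) (λ b₀ → sumℤ (map (F ∘ cons b₀) (below m (tailExp a))))
sum-below m a F = trans (sum-concatMap F (λ b₀ → map (cons b₀) (below m (tailExp a))) (upTo (suc (a zero))))
  (trans (sum-cong (upTo (suc (a zero))) (λ b₀ → sum-map-map F (cons b₀) (below m (tailExp a))))
         (sum-upTo (suc (a zero)) (λ b₀ → sumℤ (map (F ∘ cons b₀) (below m (tailExp a))))))

cons-≤ₑ : ∀ {m} {t} {b : Exp m} {a : Exp (suc m)} → t ≤ a zero → b ≤ₑ tailExp a → cons t b ≤ₑ a
cons-≤ₑ t≤ b≤ zero = t≤
cons-≤ₑ t≤ b≤ (suc i) = b≤ i

sum-below-cong : ∀ m (a : Exp m) {F G : Exp m → ℤ} → (∀ b → b ≤ₑ a → F b ≡ G b) →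
  sumℤ (map F (below m a)) ≡ sumℤ (map G (below m a))
sum-below-cong zero a h = cong (_+ℤ 0ℤ) (h (λ ()) (λ ()))
sum-below-cong (suc m) a {F} {G} h = trans (sum-below m a F) (trans
  (Σ<-cong (suc (a zero)) (λ t lt → sum-below-cong m (tailExp a) (λ b le → h (cons t b) (cons-≤ₑ (NP.≤-pred lt) le))))
  (sym (sum-below m a G)))

sum-below-zero : ∀ m (a : Exp m) (F : Exp m → ℤ) → (∀ b → b ≤ₑ a → F b ≡ 0ℤ) → sumℤ (map F (below m a)) ≡ 0ℤ
sum-below-zero zero a F h = cong (_+ℤ 0ℤ) (h (λ ()) (λ ()))
sum-below-zero (suc m) a F h = trans (sum-below m a F) (Σ<-zero (suc (a zero))
  (λ t lt → sum-below-zero m (tailExp a) (F ∘ cons t) (λ b le → h (cons t b) (cons-≤ₑ (NP.≤-pred lt) le))))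

sum-below-single : ∀ m (a : Exp m) (F : Exp m → ℤ) (c : Exp m) → Extensional F → c ≤ₑ a →
  (∀ b → b ≤ₑ a → ¬ (b ≗ c) → F b ≡ 0ℤ) → sumℤ (map F (below m a)) ≡ F c
sum-below-single zero a F c extF c≤a h = trans (ZP.+-identityʳ _) (extF (λ ()))
sum-below-single (suc m) a F c extF c≤a h = begin
  sumℤ (map F (below (suc m) a))
    ≡⟨ sum-below m a F ⟩
  Σ< (suc (a zero)) (λ t → sumℤ (map (F ∘ cons t) (below m (tailExp a))))
    ≡⟨ Σ<-single (suc (a zero)) (c zero) (s≤s (c≤a zero)) off-head ⟩
  sumℤ (map (F ∘ cons (c zero)) (below m (tailExp a)))
    ≡⟨ sum-below-single m (tailExp a) (F ∘ cons (c zero)) (tailExp c) extTail (c≤a ∘ suc) off-tail ⟩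
  F (cons (c zero) (tailExp c))
    ≡⟨ extF (cons-tailExp c) ⟩
  F c ∎
  where
  open ≡-Reasoning
  off-head : ∀ t → t < suc (a zero) → t ≢ c zero → sumℤ (map (F ∘ cons t) (below m (tailExp a))) ≡ 0ℤ
  off-head t lt ne = sum-below-zero m (tailExp a) (F ∘ cons t)
    (λ b le → h (cons t b) (cons-≤ₑ (NP.≤-pred lt) le) (λ eq → ne (eq zero)))
  extTail : Extensional (F ∘ cons (c zero))
  extTail e = extF (λ { zero → refl ; (suc i) → e i })
  off-tail : ∀ b → b ≤ₑ tailExp a → ¬ (b ≗ tailExp c) → F (cons (c zero) b) ≡ 0ℤ
  off-tail b le ne = h (cons (c zero) b) (cons-≤ₑ (c≤a zero) le) (λ eq → ne (eq ∘ suc))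

⊛-ext : ∀ {m} (f g : PS m) → Extensional g → Extensional (f ⊛ g)
⊛-ext {m} f g extg {x} {y} h rewrite below-cong m h =
  sum-cong (below m y) (λ b → cong (f b *ℤ_) (extg (λ i → cong (_∸ b i) (h i))))

⊛-congˡ : ∀ {m} {f f′ : PS m} (g : PS m) → (∀ b → f b ≡ f′ b) → ∀ a → (f ⊛ g) a ≡ (f′ ⊛ g) a
⊛-congˡ {m} g h a = sum-cong (below m a) (λ b → cong (_*ℤ g (a ∸ₑ b)) (h b))

⊛-congʳ : ∀ {m} (f : PS m) {g g′ : PS m} → (∀ b → g b ≡ g′ b) → ∀ a → (f ⊛ g) a ≡ (f ⊛ g′) a
⊛-congʳ {m} f h a = sum-cong (below m a) (λ b → cong (f b *ℤ_) (h (a ∸ₑ b)))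

mono-⊛ : ∀ {m} (e : Exp m) (g : PS m) (a : Exp m) → Extensional g → e ≤ₑ a → (mono e ⊛ g) a ≡ g (a ∸ₑ e)
mono-⊛ {m} e g a extg e≤a = trans
  (sum-below-single m a (λ b → mono e b *ℤ g (a ∸ₑ b)) e
     (λ h → cong₂ _*ℤ_ (mono-ext e h) (extg (λ i → cong (a i ∸_) (h i)))) e≤a
     (λ b _ ne → cong (_*ℤ g (a ∸ₑ b)) (mono-miss (λ q → ne (sym ∘ q)))))
  (trans (cong (_*ℤ g (a ∸ₑ e)) (mono-hit {e = e} (λ i → refl))) (ZP.*-identityˡ _))

mono-⊛-out : ∀ {m} (e : Exp m) (g : PS m) (a : Exp m) → ¬ (e ≤ₑ a) → (mono e ⊛ g) a ≡ 0ℤ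
mono-⊛-out {m} e g a e≰a = sum-below-zero m a _
  (λ b b≤a → cong (_*ℤ g (a ∸ₑ b)) (mono-miss (λ q → e≰a (λ i → subst (_≤ a i) (sym (q i)) (b≤a i)))))

⊛-mono : ∀ {m} (f : PS m) (e : Exp m) (a : Exp m) → Extensional f → e ≤ₑ a → (f ⊛ mono e) a ≡ f (a ∸ₑ e)
⊛-mono {m} f e a extf e≤a = trans
  (sum-below-single m a (λ b → f b *ℤ mono e (a ∸ₑ b)) (a ∸ₑ e)
     (λ h → cong₂ _*ℤ_ (extf h) (mono-ext e (λ i → cong (a i ∸_) (h i)))) (λ i → NP.m∸n≤m (a i) (e i)) off)
  (trans (cong (f (a ∸ₑ e) *ℤ_) (mono-hit (λ i → sym (NP.m∸[m∸n]≡n (e≤a i))))) (ZP.*-identityʳ _))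
  where
  off : ∀ b → b ≤ₑ a → ¬ (b ≗ a ∸ₑ e) → f b *ℤ mono e (a ∸ₑ b) ≡ 0ℤ
  off b b≤a ne = trans (cong (f b *ℤ_) (mono-miss {e = e} {a ∸ₑ b}
      (λ q → ne (λ i → trans (sym (NP.m∸[m∸n]≡n (b≤a i))) (cong (a i ∸_) (sym (q i)))))))
    (ZP.*-zeroʳ (f b))

⊛-mono-out : ∀ {m} (f : PS m) (e : Exp m) (a : Exp m) → ¬ (e ≤ₑ a) → (f ⊛ mono e) a ≡ 0ℤ
⊛-mono-out {m} f e a e≰a = sum-below-zero m a _
  (λ b _ → trans (cong (f b *ℤ_) (mono-miss (λ q → e≰a (λ i → subst (_≤ a i) (sym (q i)) (NP.m∸n≤m (a i) (b i))))))
    (ZP.*-zeroʳ (f b)))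

mono-⊛-mono : ∀ {m} (e f : Exp m) (b : Exp m) → (mono e ⊛ mono f) b ≡ mono (addExp e f) b
mono-⊛-mono e f b with e ≤ₑ? b
... | yes e≤b = trans (mono-⊛ e (mono f) b (mono-ext f) e≤b)
  (cong indicator (eqExp-iff (λ q i → trans (cong (e i +_) (q i)) (NP.m+[n∸m]≡n (e≤b i)))
                             (λ q i → trans (sym (NP.m+n∸m≡n (e i) (f i))) (cong (_∸ e i) (q i)))))
... | no e≰b = trans (mono-⊛-out e (mono f) b e≰b)
  (sym (mono-miss (λ q → e≰b (λ i → subst (e i ≤_) (q i) (NP.m≤m+n (e i) (f i))))))

leExp : ∀ {m} → Exp m → Exp m → Bool
leExp {zero} e b = true
leExp {suc m} e b = (e zero ≤ᵇ b zero) ∧ leExp (tailExp e) (tailExp b)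

leExp-sound : ∀ {m} {e b : Exp m} → leExp e b ≡ true → e ≤ₑ b
leExp-sound {suc m} {e} {b} h zero = ≤ᵇ-sound (∧-true₁ {e zero ≤ᵇ b zero} h)
leExp-sound {suc m} {e} {b} h (suc i) = leExp-sound {m} {tailExp e} {tailExp b} (∧-true₂ {e zero ≤ᵇ b zero} h) i

leExp-complete : ∀ {m} {e b : Exp m} → e ≤ₑ b → leExp e b ≡ true
leExp-complete {zero} h = refl
leExp-complete {suc m} {e} {b} h rewrite ≤ᵇ-complete (h zero) = leExp-complete {m} {tailExp e} {tailExp b} (h ∘ suc)

leExp-false : ∀ {m} {e b : Exp m} → leExp e b ≡ false → ¬ (e ≤ₑ b)
leExp-false eq h = true≢false (leExp-complete h) eq

sum-below-shift : ∀ m (a e : Exp m) (Φ : PS m) → Extensional Φ →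
  sumℤ (map (λ b → if leExp e b then Φ (b ∸ₑ e) else 0ℤ) (below m a))
    ≡ (if leExp e a then sumℤ (map Φ (below m (a ∸ₑ e))) else 0ℤ)
sum-below-shift zero a e Φ extΦ = cong (_+ℤ 0ℤ) (extΦ (λ ()))
sum-below-shift (suc m) a e Φ extΦ = trans (sum-below m a _) (trans
  (Σ<-cong (suc (a zero)) (λ b₀ _ → step b₀))
  (trans (Σ<-shift (a zero) (e zero) X) final))
  where
  X : ℕ → ℤ
  X t = if leExp (tailExp e) (tailExp a) then sumℤ (map (Φ ∘ cons t) (below m (tailExp a ∸ₑ tailExp e))) else 0ℤ
  step : ∀ b₀ → sumℤ (map ((λ b → if leExp e b then Φ (b ∸ₑ e) else 0ℤ) ∘ cons b₀) (below m (tailExp a)))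
              ≡ (if e zero ≤ᵇ b₀ then X (b₀ ∸ e zero) else 0ℤ)
  step b₀ with e zero ≤ᵇ b₀
  ... | false = sum-zero (below m (tailExp a)) (λ _ → refl)
  ... | true = trans (sum-cong (below m (tailExp a)) (λ b → cong (λ c → if leExp (tailExp e) b then c else 0ℤ)
                      (extΦ (λ { zero → refl ; (suc i) → refl }))))
               (sum-below-shift m (tailExp a) (tailExp e) (Φ ∘ cons (b₀ ∸ e zero)) (λ q → extΦ (λ { zero → refl ; (suc i) → q i })))
  final : (if e zero ≤ᵇ a zero then Σ< (suc (a zero ∸ e zero)) X else 0ℤ) ≡
          (if leExp e a then sumℤ (map Φ (below (suc m) (a ∸ₑ e))) else 0ℤ)
  final with e zero ≤ᵇ a zero | leExp (tailExp e) (tailExp a)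
  ... | false | _ = refl
  ... | true | false = Σ<-zero (suc (a zero ∸ e zero)) (λ _ _ → refl)
  ... | true | true = sym (sum-below m (a ∸ₑ e) Φ)

[a∸e]∸[b∸e]≡a∸b : ∀ {a b e} → e ≤ b → (a ∸ e) ∸ (b ∸ e) ≡ a ∸ b
[a∸e]∸[b∸e]≡a∸b {a} {b} {e} e≤b = trans (NP.∸-+-assoc a e (b ∸ e)) (cong (a ∸_) (NP.m+[n∸m]≡n e≤b))

mono-⊛-⊛ : ∀ {m} (e : Exp m) (g h : PS m) (a : Exp m) → Extensional g → Extensional h →
  ((mono e ⊛ g) ⊛ h) a ≡ (if leExp e a then (g ⊛ h) (a ∸ₑ e) else 0ℤ)
mono-⊛-⊛ {m} e g h a extg exth = trans
  (sum-below-cong m a (λ b _ → summand b))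
  (sum-below-shift m a e (λ b′ → g b′ *ℤ h ((a ∸ₑ e) ∸ₑ b′)) (λ q → cong₂ _*ℤ_ (extg q) (exth (λ i → cong (a i ∸ e i ∸_) (q i)))))
  where
  summand : ∀ b → (mono e ⊛ g) b *ℤ h (a ∸ₑ b) ≡ (if leExp e b then g (b ∸ₑ e) *ℤ h ((a ∸ₑ e) ∸ₑ (b ∸ₑ e)) else 0ℤ)
  summand b with leExp e b in eq
  ... | true = cong₂ _*ℤ_ (mono-⊛ e g b extg (leExp-sound eq)) (exth (λ i → sym ([a∸e]∸[b∸e]≡a∸b (leExp-sound eq i))))
  ... | false = cong (_*ℤ h (a ∸ₑ b)) (mono-⊛-out e g b (leExp-false eq))

entry≤sumOn : ∀ {k m} (b : Exp m) (f : Fin k → Fin m) (j : Fin k) → b (f j) ≤ sumℕ (map b (tabulate f))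
entry≤sumOn b f zero = NP.m≤m+n _ _
entry≤sumOn b f (suc j) = NP.m≤n⇒m≤o+n (b (f zero)) (entry≤sumOn b (f ∘ suc) j)

entry≤deg : ∀ {m} (b : Exp m) i → b i ≤ deg b
entry≤deg b i = entry≤sumOn b id i

deg-cong : ∀ {m} {x y : Exp m} → x ≗ y → deg x ≡ deg y
deg-cong {m} h = cong sumℕ (LP.map-cong h (allFin m))

geom-ext : ∀ {m} (e : Exp m) → Extensional (geom e)
geom-ext e {x} {y} h rewrite deg-cong h = sum-cong (upTo (suc (deg y))) (λ k → mono-ext (scale k e) h)

geom-off-multiples : ∀ {m} (e : Exp m) (b : Exp m) (z : ℤ) → (∀ t → scale t e ≗ b → z ≡ 0ℤ) → geom e b *ℤ z ≡ 0ℤ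
geom-off-multiples e b z hz with z ZP.≟ 0ℤ
... | yes z≡0 = trans (cong (geom e b *ℤ_) z≡0) (ZP.*-zeroʳ (geom e b))
... | no z≢0 = cong (_*ℤ z) (sum-zero (upTo (suc (deg b))) λ t → mono-miss (λ q → z≢0 (hz t q)))

geom-⊛-zero : ∀ {m} (e : Exp m) (h : PS m) (y : Exp m) →
  (∀ b t → b ≤ₑ y → scale t e ≗ b → h (y ∸ₑ b) ≡ 0ℤ) → (geom e ⊛ h) y ≡ 0ℤ
geom-⊛-zero {m} e h y hz = sum-below-zero m y _ (λ b b≤y → geom-off-multiples e b (h (y ∸ₑ b)) (λ t q → hz b t b≤y q))

geom-at-multiple : ∀ {m} (e : Exp m) (i₀ : Fin m) (p : ℕ) → e i₀ ≡ suc p → ∀ K → geom e (scale K e) ≡ 1ℤ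
geom-at-multiple e i₀ p ep K = trans (sum-upTo (suc (deg (scale K e))) (λ k → mono (scale k e) (scale K e))) (trans
  (Σ<-single (suc (deg (scale K e))) K K<deg
    (λ t _ ne → mono-miss {e = scale t e} {scale K e} (λ q → ne (NP.*-cancelʳ-≡ t K (suc p) (subst (λ s → t * s ≡ K * s) ep (q i₀))))))
  (mono-hit {e = scale K e} {scale K e} (λ i → refl)))
  where
  K<deg : K < suc (deg (scale K e))
  K<deg = s≤s (NP.≤-trans (subst (K ≤_) (cong (K *_) (sym ep)) (NP.m≤m*n K (suc p))) (entry≤deg (scale K e) i₀))

geom-⊛-single : ∀ {m} (e : Exp m) (i₀ : Fin m) (p : ℕ) → e i₀ ≡ suc p → (h : PS m) → Extensional h → (y : Exp m) (K : ℕ) →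
  scale K e ≤ₑ y → (∀ b t → b ≤ₑ y → scale t e ≗ b → t ≢ K → h (y ∸ₑ b) ≡ 0ℤ) → (geom e ⊛ h) y ≡ h (y ∸ₑ scale K e)
geom-⊛-single {m} e i₀ p ep h exth y K Ke≤y hz = trans
  (sum-below-single m y (λ b → geom e b *ℤ h (y ∸ₑ b)) (scale K e)
     (λ q → cong₂ _*ℤ_ (geom-ext e q) (exth (λ i → cong (y i ∸_) (q i)))) Ke≤y
     (λ b b≤y ne → geom-off-multiples e b (h (y ∸ₑ b))
        (λ t q → hz b t b≤y q (λ t≡K → ne (λ i → trans (sym (q i)) (cong (λ s → s * e i) t≡K))))))
  (trans (cong (_*ℤ h (y ∸ₑ scale K e)) (geom-at-multiple e i₀ p ep K)) (ZP.*-identityˡ _))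

ΣL-eval : ∀ {m} (fs : List (PS m)) a → ΣL fs a ≡ sumℤ (map (λ f → f a) fs)
ΣL-eval [] a = refl
ΣL-eval (f ∷ fs) a = cong (f a +ℤ_) (ΣL-eval fs a)

data Distinct {A : Set} : List A → Set where
  [] : Distinct []
  _∷_ : ∀ {x xs} → ¬ (x ∈ xs) → Distinct xs → Distinct (x ∷ xs)

distinct-tabulate : ∀ {k m} (f : Fin k → Fin m) → (∀ {a b} → f a ≡ f b → a ≡ b) → Distinct (tabulate f)
distinct-tabulate {zero} f inj = []
distinct-tabulate {suc k} f inj = head∉ ∷ distinct-tabulate (f ∘ suc) (FP.suc-injective ∘ inj)
  where
  head∉ : ¬ (f zero ∈ tabulate (f ∘ suc))
  head∉ p with ∈-tabulate⁻ p
  ... | i , e with inj e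
  ... | ()

unit-self : ∀ {m} (i : Fin m) → unit i i ≡ 1
unit-self zero = refl
unit-self (suc i) = unit-self i

unit-other : ∀ {m} (i j : Fin m) → i ≢ j → unit i j ≡ 0
unit-other zero zero ne = ⊥-elim (ne refl)
unit-other zero (suc j) ne = refl
unit-other (suc i) zero ne = refl
unit-other (suc i) (suc j) ne = unit-other i j (ne ∘ cong suc)

scaleUnit-other : ∀ {m} s (i j : Fin m) → i ≢ j → scale s (unit i) j ≡ 0
scaleUnit-other s i j ne = trans (cong (s *_) (unit-other i j ne)) (NP.*-zeroʳ s)

scaleUnit-self : ∀ {m} s (i : Fin m) → scale s (unit i) i ≡ s
scaleUnit-self s i = trans (cong (s *_) (unit-self i)) (NP.*-identityʳ s)

scaleUnit-≤ : ∀ {m} s (i : Fin m) (y : Exp m) → s ≤ y i → scale s (unit i) ≤ₑ y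
scaleUnit-≤ s i y le j with i FP.≟ j
... | yes refl = subst (_≤ y i) (sym (scaleUnit-self s i)) le
... | no ne = subst (_≤ y j) (sym (scaleUnit-other s i j ne)) z≤n

scaleUnit-≰ : ∀ {m} s (i : Fin m) (y : Exp m) → ¬ (s ≤ y i) → ¬ (scale s (unit i) ≤ₑ y)
scaleUnit-≰ s i y s≰ h = s≰ (subst (_≤ y i) (scaleUnit-self s i) (h i))

∸-scaleUnit-other : ∀ {m} s (i j : Fin m) (y : Exp m) → i ≢ j → (y ∸ₑ scale s (unit i)) j ≡ y j
∸-scaleUnit-other s i j y ne = cong (y j ∸_) (scaleUnit-other s i j ne)

∸-scaleUnit-self≡0 : ∀ {m} s (i : Fin m) (y : Exp m) → (y ∸ₑ scale s (unit i)) i ≡ 0 → y i ≤ s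
∸-scaleUnit-self≡0 s i y e = NP.m∸n≡0⇒m≤n (trans (cong (y i ∸_) (sym (scaleUnit-self s i))) e)

scaleUnit-⊛-zero : ∀ {m} s (i : Fin m) (g : PS m) (y : Exp m) → Extensional g →
  (s ≤ y i → g (y ∸ₑ scale s (unit i)) ≡ 0ℤ) → (mono (scale s (unit i)) ⊛ g) y ≡ 0ℤ
scaleUnit-⊛-zero s i g y extg h with s ≤? y i
... | yes s≤ = trans (mono-⊛ _ g y extg (scaleUnit-≤ s i y s≤)) (h s≤)
... | no s≰ = mono-⊛-out _ g y (scaleUnit-≰ s i y s≰)

ΠL-ext : ∀ {m} (fs : List (PS m)) → Extensional (ΠL fs)
ΠL-ext [] = mono-ext zeroExp
ΠL-ext (f ∷ fs) = ⊛-ext f (ΠL fs) (ΠL-ext fs)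

ΣL-⊛ : ∀ {m} (fs : List (PS m)) (g : PS m) y → (ΣL fs ⊛ g) y ≡ sumℤ (map (λ f → (f ⊛ g) y) fs)
ΣL-⊛ {m} fs g y = trans
  (sum-cong (below m y) (λ b → trans (cong (_*ℤ g (y ∸ₑ b)) (ΣL-eval fs b)) (sum-distribʳ (λ f → f b) (g (y ∸ₑ b)) fs)))
  (sum-swap (λ f b → f b *ℤ g (y ∸ₑ b)) fs (below m y))

qint-⊛ : ∀ {m} r (i : Fin m) (g : PS m) y → (qint r i ⊛ g) y ≡ Σ< r (λ s → (mono (scale s (unit i)) ⊛ g) y)
qint-⊛ r i g y = trans (ΣL-⊛ (map (λ s → mono (scale s (unit i))) (upTo r)) g y)
  (trans (sum-map-map (λ f → (f ⊛ g) y) (λ s → mono (scale s (unit i))) (upTo r))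
         (sum-upTo r (λ s → (mono (scale s (unit i)) ⊛ g) y)))

Πqint : ∀ {m} → ℕ → List (Fin m) → PS m
Πqint r L = ΠL (map (qint r) L)

Πqint-outside : ∀ {m} r (L : List (Fin m)) (y : Exp m) (i : Fin m) → ¬ (i ∈ L) → y i ≢ 0 → Πqint r L y ≡ 0ℤ
Πqint-outside r [] y i _ yi≢0 = mono-miss {e = zeroExp} {y} (λ q → yi≢0 (sym (q i)))
Πqint-outside r (i′ ∷ L) y i i∉ yi≢0 = trans (qint-⊛ r i′ (Πqint r L) y) (Σ<-zero r (λ s _ →
  scaleUnit-⊛-zero s i′ (Πqint r L) y (ΠL-ext (map (qint r) L)) (λ _ →
    Πqint-outside r L (y ∸ₑ scale s (unit i′)) i (i∉ ∘ there)
      (λ e → yi≢0 (trans (sym (∸-scaleUnit-other s i′ i y (λ e′ → i∉ (here (sym e′))))) e)))))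

Πqint-exceeds : ∀ {m} r (L : List (Fin m)) → Distinct L → (y : Exp m) (i : Fin m) → i ∈ L → r ≤ y i → Πqint r L y ≡ 0ℤ
Πqint-exceeds r (i ∷ L) (i∉ ∷ _) y .i (here refl) r≤ = trans (qint-⊛ r i (Πqint r L) y) (Σ<-zero r (λ s s<r →
  scaleUnit-⊛-zero s i (Πqint r L) y (ΠL-ext (map (qint r) L)) (λ _ →
    Πqint-outside r L (y ∸ₑ scale s (unit i)) i i∉
      (λ e → NP.≤⇒≯ (∸-scaleUnit-self≡0 s i y e) (NP.<-≤-trans s<r r≤)))))
Πqint-exceeds r (i′ ∷ L) (i′∉ ∷ d) y i (there p) r≤ = trans (qint-⊛ r i′ (Πqint r L) y) (Σ<-zero r (λ s _ →
  scaleUnit-⊛-zero s i′ (Πqint r L) y (ΠL-ext (map (qint r) L)) (λ _ →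
    Πqint-exceeds r L d (y ∸ₑ scale s (unit i′)) i p
      (subst (r ≤_) (sym (∸-scaleUnit-other s i′ i y (λ e → i′∉ (subst (_∈ L) (sym e) p)))) r≤))))

Πqint-within : ∀ {m} r (L : List (Fin m)) → Distinct L → (y : Exp m) →
  (∀ i → ¬ (i ∈ L) → y i ≡ 0) → (∀ i → i ∈ L → y i < r) → Πqint r L y ≡ 1ℤ
Πqint-within r [] d y out _ = mono-hit {e = zeroExp} {y} (λ i → sym (out i (λ ())))
Πqint-within r (i ∷ L) (i∉ ∷ d) y out within = begin
  Πqint r (i ∷ L) y
    ≡⟨ qint-⊛ r i (Πqint r L) y ⟩
  Σ< r (λ s → (mono (scale s (unit i)) ⊛ Πqint r L) y)
    ≡⟨ Σ<-single r (y i) (within i (here refl)) other-powers ⟩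
  (mono (scale (y i) (unit i)) ⊛ Πqint r L) y
    ≡⟨ mono-⊛ _ _ y (ΠL-ext (map (qint r) L)) (scaleUnit-≤ (y i) i y NP.≤-refl) ⟩
  Πqint r L y′
    ≡⟨ Πqint-within r L d y′ out′ within′ ⟩
  1ℤ ∎
  where
  open ≡-Reasoning
  y′ = y ∸ₑ scale (y i) (unit i)
  other-powers : ∀ s → s < r → s ≢ y i → (mono (scale s (unit i)) ⊛ Πqint r L) y ≡ 0ℤ
  other-powers s _ s≢ = scaleUnit-⊛-zero s i (Πqint r L) y (ΠL-ext (map (qint r) L)) (λ s≤ →
    Πqint-outside r L (y ∸ₑ scale s (unit i)) i i∉ (λ e → s≢ (NP.≤-antisym s≤ (∸-scaleUnit-self≡0 s i y e))))
  out′ : ∀ j → ¬ (j ∈ L) → y′ j ≡ 0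
  out′ j j∉ with i FP.≟ j
  ... | yes refl = trans (cong (y i ∸_) (scaleUnit-self (y i) i)) (NP.n∸n≡0 (y i))
  ... | no ne = trans (∸-scaleUnit-other (y i) i j y ne) (out j (λ { (here e) → ne (sym e) ; (there p) → j∉ p }))
  within′ : ∀ j → j ∈ L → y′ j < r
  within′ j j∈ = subst (_< r) (sym (∸-scaleUnit-other (y i) i j y (λ e → i∉ (subst (_∈ L) (sym e) j∈)))) (within j (there j∈))

zs : ∀ n → List (Fin (suc n))
zs n = tabulate suc

z₀∉zs : ∀ {n} → ¬ (zero ∈ zs n)
z₀∉zs p with ∈-tabulate⁻ {f = suc} p
... | _ , ()

distinct-zs : ∀ n → Distinct (zs n)
distinct-zs n = distinct-tabulate suc FP.suc-injective

LHS-summand : ∀ n → ℕ → PS (suc n)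
LHS-summand n k = Πqint (suc k) (zs n) ⊛ mono (scale k (unit zero))

LHS-unfold : ∀ n a → LHS n a ≡ sumℤ (map (λ k → LHS-summand n k a) (upTo (suc (deg a))))
LHS-unfold n a = sum-cong (upTo (suc (deg a))) (λ k → ⊛-congˡ (mono (scale k (unit zero)))
  (λ b → cong (λ l → ΠL l b) (trans (LP.map-tabulate id (λ j → qint (suc k) (suc j))) (sym (LP.map-tabulate suc (qint (suc k))))))
  a)

LHS-summand-zero : ∀ n (a : Exp (suc n)) k →
  (k ≤ a zero → Πqint (suc k) (zs n) (a ∸ₑ scale k (unit zero)) ≡ 0ℤ) → LHS-summand n k a ≡ 0ℤ
LHS-summand-zero n a k h with k ≤? a zero
... | yes k≤ = trans (⊛-mono (Πqint (suc k) (zs n)) (scale k (unit zero)) a (ΠL-ext (map (qint (suc k)) (zs n)))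
                       (scaleUnit-≤ k zero a k≤)) (h k≤)
... | no k≰ = ⊛-mono-out (Πqint (suc k) (zs n)) (scale k (unit zero)) a (scaleUnit-≰ k zero a k≰)

LHS-dominant : ∀ n (a : Exp (suc n)) → (∀ j → a (suc j) ≤ a zero) → LHS n a ≡ 1ℤ
LHS-dominant n a dominant = begin
  LHS n a
    ≡⟨ LHS-unfold n a ⟩
  sumℤ (map (λ k → LHS-summand n k a) (upTo (suc (deg a))))
    ≡⟨ sum-upTo (suc (deg a)) (λ k → LHS-summand n k a) ⟩
  Σ< (suc (deg a)) (λ k → LHS-summand n k a)
    ≡⟨ Σ<-single (suc (deg a)) (a zero) (s≤s (entry≤deg a zero)) other-k ⟩
  LHS-summand n (a zero) a
    ≡⟨ ⊛-mono (Πqint (suc (a zero)) (zs n)) (scale (a zero) (unit zero)) a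
              (ΠL-ext (map (qint (suc (a zero))) (zs n))) (scaleUnit-≤ (a zero) zero a NP.≤-refl) ⟩
  Πqint (suc (a zero)) (zs n) a′
    ≡⟨ Πqint-within (suc (a zero)) (zs n) (distinct-zs n) a′ out within ⟩
  1ℤ ∎
  where
  open ≡-Reasoning
  a′ : Exp (suc n)
  a′ = a ∸ₑ scale (a zero) (unit zero)
  other-k : ∀ k → k < suc (deg a) → k ≢ a zero → LHS-summand n k a ≡ 0ℤ
  other-k k _ k≢ = LHS-summand-zero n a k (λ k≤ → Πqint-outside (suc k) (zs n) (a ∸ₑ scale k (unit zero)) zero z₀∉zs
    (λ e → k≢ (NP.≤-antisym k≤ (∸-scaleUnit-self≡0 k zero a e))))
  out : ∀ i → ¬ (i ∈ zs n) → a′ i ≡ 0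
  out zero _ = trans (cong (a zero ∸_) (scaleUnit-self (a zero) (zero {n}))) (NP.n∸n≡0 (a zero))
  out (suc j) j∉ = ⊥-elim (j∉ (∈-tabulate⁺ j))
  within : ∀ i → i ∈ zs n → a′ i < suc (a zero)
  within zero z∈ = ⊥-elim (z₀∉zs z∈)
  within (suc j) _ = s≤s (NP.≤-trans (NP.m∸n≤m (a (suc j)) (scale (a zero) (unit zero) (suc j))) (dominant j))

LHS-not-dominant : ∀ n (a : Exp (suc n)) (j : Fin n) → a zero < a (suc j) → LHS n a ≡ 0ℤ
LHS-not-dominant n a j a₀<aⱼ = trans (LHS-unfold n a) (sum-zero (upTo (suc (deg a))) (λ k → LHS-summand-zero n a k (λ k≤ →
  Πqint-exceeds (suc k) (zs n) (distinct-zs n) (a ∸ₑ scale k (unit zero)) (suc j) (∈-tabulate⁺ j)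
    (subst (suc k ≤_) (sym (∸-scaleUnit-other k zero (suc j) a (λ ()))) (NP.≤-<-trans k≤ a₀<aⱼ)))))

-- Coordinates outside the range read as 0.
entry : ∀ {m} → Exp m → ℕ → ℕ
entry {zero} y v = 0
entry {suc m} y zero = y zero
entry {suc m} y (suc v) = entry (tailExp y) v

-- The exponent of z_v for v ≥ 1 (index suc i of y is z_{i+1}); junk value 0 at v = 0.
exponentOf : ∀ {m} → Exp (suc m) → ℕ → ℕ
exponentOf y zero = 0
exponentOf y (suc w) = entry (tailExp y) w

entry-toℕ : ∀ {m} (y : Exp m) (i : Fin m) → entry y (toℕ i) ≡ y i
entry-toℕ y zero = refl
entry-toℕ y (suc i) = entry-toℕ (tailExp y) i

entry-op : ∀ {m} (g : ℕ → ℕ → ℕ) → g 0 0 ≡ 0 → (x y : Exp m) (v : ℕ) →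
  entry (λ i → g (x i) (y i)) v ≡ g (entry x v) (entry y v)
entry-op {zero} g g0 x y v = sym g0
entry-op {suc m} g g0 x y zero = refl
entry-op {suc m} g g0 x y (suc v) = entry-op g g0 (tailExp x) (tailExp y) v

entry-cong : ∀ {m} {x y : Exp m} → x ≗ y → ∀ v → entry x v ≡ entry y v
entry-cong {zero} h v = refl
entry-cong {suc m} h zero = h zero
entry-cong {suc m} h (suc v) = entry-cong (h ∘ suc) v

entry-mono : ∀ {m} {x y : Exp m} → x ≤ₑ y → ∀ v → entry x v ≤ entry y v
entry-mono {zero} h v = z≤n
entry-mono {suc m} h zero = h zero
entry-mono {suc m} h (suc v) = entry-mono (h ∘ suc) v

entry-tabulate : ∀ {m} (h : ℕ → ℕ) (w : ℕ) → w < m → entry {m} (λ i → h (toℕ i)) w ≡ h w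
entry-tabulate {suc m} h zero lt = refl
entry-tabulate {suc m} h (suc w) (s≤s lt) = entry-tabulate (h ∘ suc) w lt

nth : List ℕ → ℕ → ℕ
nth [] p = 0
nth (x ∷ xs) zero = x
nth (x ∷ xs) (suc p) = nth xs p

nth-∈ : ∀ l (p : ℕ) → p < length l → nth l p ∈ l
nth-∈ (x ∷ l) zero lt = here refl
nth-∈ (x ∷ l) (suc p) (s≤s lt) = there (nth-∈ l p lt)

∈-nth : ∀ {v} l → v ∈ l → ∃ λ p → p < length l × nth l p ≡ v
∈-nth (x ∷ l) (here refl) = 0 , s≤s z≤n , refl
∈-nth (x ∷ l) (there q) with ∈-nth l q
... | p , lt , e = suc p , s≤s lt , e

nth-beyond : ∀ (l : List ℕ) p → length l ≤ p → nth l p ≡ 0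
nth-beyond [] p le = refl
nth-beyond (x ∷ l) (suc p) (s≤s le) = nth-beyond l p le

nth∈take : ∀ (l : List ℕ) → Distinct l → ∀ (p j : ℕ) → p < length l → memᵇ (nth l p) (take j l) ≡ (p <ᵇ j)
nth∈take (x ∷ l) d zero zero lt = refl
nth∈take (x ∷ l) d zero (suc j) lt rewrite ≡ᵇ-refl x = refl
nth∈take (x ∷ l) d (suc p) zero lt = refl
nth∈take (x ∷ l) (x∉ ∷ d) (suc p) (suc j) (s≤s lt)
  rewrite ≡ᵇ-false {nth l p} {x} (λ e → x∉ (subst (_∈ l) e (nth-∈ l p lt))) = nth∈take l d p j lt

record IsPerm (n : ℕ) (π : List ℕ) : Set where
  field
    len : length π ≡ n
    dist : Distinct π
    rng : ∀ v → v ∈ π → 1 ≤ v × v ≤ n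
    cov : ∀ v → 1 ≤ v → v ≤ n → v ∈ π

-- Reading an exponent vector along π: position 0 is z_0, position q ∈ [1,n]
-- is z_{π(q)}, and positions beyond n read 0.  In these coordinates the
-- monomial z_0 z_{π(1)} ⋯ z_{π(j)} becomes the indicator of [0, j].
module AlongPermutation (n : ℕ) (π : List ℕ) (P : IsPerm n π) where
  open IsPerm P

  along : Exp (suc n) → ℕ → ℕ
  along y zero = y zero
  along y (suc p) = exponentOf y (nth π p)

  along-op : (g : ℕ → ℕ → ℕ) → g 0 0 ≡ 0 → (x y : Exp (suc n)) (q : ℕ) →
    along (λ i → g (x i) (y i)) q ≡ g (along x q) (along y q)
  along-op g g0 x y zero = refl
  along-op g g0 x y (suc p) with nth π p
  ... | zero = sym g0
  ... | suc w = entry-op g g0 (tailExp x) (tailExp y) w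

  along-op₁ : (g : ℕ → ℕ) → g 0 ≡ 0 → (x : Exp (suc n)) (q : ℕ) → along (λ i → g (x i)) q ≡ g (along x q)
  along-op₁ g g0 x q = along-op (λ u _ → g u) g0 x x q

  along-cong : ∀ {x y : Exp (suc n)} → x ≗ y → ∀ q → along x q ≡ along y q
  along-cong h zero = h zero
  along-cong h (suc p) with nth π p
  ... | zero = refl
  ... | suc w = entry-cong (h ∘ suc) w

  along-mono : ∀ {x y : Exp (suc n)} → x ≤ₑ y → ∀ q → along x q ≤ along y q
  along-mono h zero = h zero
  along-mono h (suc p) with nth π p
  ... | zero = z≤n
  ... | suc w = entry-mono (h ∘ suc) w

  along-zeroExp : ∀ q → along zeroExp q ≡ 0
  along-zeroExp q = along-op₁ (λ _ → 0) refl zeroExp q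

  along-∸ : ∀ (x y : Exp (suc n)) q → along (x ∸ₑ y) q ≡ along x q ∸ along y q
  along-∸ = along-op _∸_ refl

  along-beyond : ∀ y → along y (suc n) ≡ 0
  along-beyond y rewrite nth-beyond π n (NP.≤-reflexive len) = refl

  along-uExp : ∀ j q → q ≤ n → along (uExp n π j) q ≡ (if q ≤ᵇ j then 1 else 0)
  along-uExp j zero _ = refl
  along-uExp j (suc p) (s≤s p<n) = along-uExp-at (nth π p) refl (rng (nth π p) (nth-∈ π p p<len))
    where
    p<len : p < length π
    p<len = subst (p <_) (sym len) (s≤s p<n)
    along-uExp-at : ∀ v → nth π p ≡ v → 1 ≤ v × v ≤ n → exponentOf (uExp n π j) v ≡ (if suc p ≤ᵇ j then 1 else 0)
    along-uExp-at (suc w) eq (_ , w<n) = trans (entry-tabulate (λ k → if memᵇ (suc k) (take j π) then 1 else 0) w w<n)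
      (cong (λ b → if b then 1 else 0) (trans (cong (λ v → memᵇ v (take j π)) (sym eq)) (nth∈take π dist p j p<len)))

  variableAt : ∀ p → p < n → ∃ λ (w : Fin n) → nth π p ≡ suc (toℕ w)
  variableAt p p<n with nth π p | rng (nth π p) (nth-∈ π p (subst (p <_) (sym len) p<n))
  ... | zero | () , _
  ... | suc w | _ , w<n = fromℕ< w<n , cong suc (sym (FP.toℕ-fromℕ< w<n))

  locate : ∀ (w : Fin n) → ∃ λ p → p < n × nth π p ≡ suc (toℕ w)
  locate w with ∈-nth π (cov (suc (toℕ w)) (s≤s z≤n) (FP.toℕ<n w))
  ... | p , lt , e = p , subst (p <_) len lt , e

  along-exponentOf : ∀ (x : Exp (suc n)) (w : Fin n) p → nth π p ≡ suc (toℕ w) → along x (suc p) ≡ x (suc w)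
  along-exponentOf x w p e = trans (cong (exponentOf x) e) (entry-toℕ (tailExp x) w)

  along-≗ : ∀ {x y : Exp (suc n)} → (∀ q → q ≤ n → along x q ≡ along y q) → x ≗ y
  along-≗ h zero = h zero z≤n
  along-≗ {x} {y} h (suc w) with locate w
  ... | p , p<n , e = trans (sym (along-exponentOf x w p e)) (trans (h (suc p) p<n) (along-exponentOf y w p e))

  along-≤ₑ : ∀ {x y : Exp (suc n)} → (∀ q → q ≤ n → along x q ≤ along y q) → x ≤ₑ y
  along-≤ₑ h zero = h zero z≤n
  along-≤ₑ {x} {y} h (suc w) with locate w
  ... | p , p<n , e = subst₂ _≤_ (along-exponentOf x w p e) (along-exponentOf y w p e) (h (suc p) p<n)

Even : ℕ → Set
Even d = ∃ λ K → d ≡ K + K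

even-*2 : ∀ t → Even (t * 2)
even-*2 t = t , trans (NP.*-comm t 2) (cong (t +_) (NP.+-identityʳ t))

-- The exponent of u_j in the denominator: 1 - z_0 for j = 0, 1 - u_j² for j ≥ 1.
uPower : ℕ → ℕ
uPower zero = 1
uPower (suc _) = 2

uPower-cancel : ∀ j t K → t * uPower j ≡ K * uPower j → t ≡ K
uPower-cancel zero t K e = trans (sym (NP.*-identityʳ t)) (trans e (NP.*-identityʳ K))
uPower-cancel (suc j) t K e = NP.*-cancelʳ-≡ t K 2 e

divide-by-uPower : ∀ j d → (1 ≤ j → Even d) → ∃ λ K → K * uPower j ≡ d
divide-by-uPower zero d _ = d , NP.*-identityʳ d
divide-by-uPower (suc j) d even with even (s≤s z≤n)
... | K , e = K , trans (NP.*-comm K 2) (trans (cong (K +_) (NP.+-identityʳ K)) (sym e))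

𝟙≤ : ℕ → ℕ → ℕ
𝟙≤ q j = if q ≤ᵇ j then 1 else 0

𝟙≤-yes : ∀ {q j} → q ≤ j → 𝟙≤ q j ≡ 1
𝟙≤-yes {q} {j} le rewrite ≤ᵇ-complete le = refl

𝟙≤-no : ∀ {q j} → j < q → 𝟙≤ q j ≡ 0
𝟙≤-no {q} {j} lt with q ≤ᵇ j in eq
... | true = ⊥-elim (NP.<⇒≱ lt (≤ᵇ-sound eq))
... | false = refl

range : ℕ → ℕ → List ℕ
range j zero = []
range j (suc l) = j ∷ range (suc j) l

-- Π_{t ∈ [j, j+l)} 1/(1 - u_t^{uPower t}) has coefficient 1 at y exactly when
-- along y is constant on [0, j] and, from j on, weakly decreasing with even
-- drops after position 0: writing y = Σ c_t uPower t u_t, the drop of along y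
-- at t is c_t uPower t.
module GeomProduct (n : ℕ) (π : List ℕ) (P : IsPerm n π) where
  open AlongPermutation n π P

  uPow : ℕ → Exp (suc n)
  uPow j = scale (uPower j) (uExp n π j)

  geomU : ℕ → PS (suc n)
  geomU j = geom (uPow j)

  ΠgeomU : ℕ → ℕ → PS (suc n)
  ΠgeomU j l = ΠL (map geomU (range j l))

  FlatUpTo : ℕ → (ℕ → ℕ) → Set
  FlatUpTo j T = ∀ q → q ≤ j → T q ≡ T 0

  EvenDropAt : ℕ → (ℕ → ℕ) → Set
  EvenDropAt q T = T (suc q) ≤ T q × (1 ≤ q → Even (T q ∸ T (suc q)))

  EvenDropsFrom : ℕ → (ℕ → ℕ) → Set
  EvenDropsFrom j T = ∀ q → j ≤ q → q ≤ n → EvenDropAt q T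

  Admissible : ℕ → (ℕ → ℕ) → Set
  Admissible j T = FlatUpTo j T × EvenDropsFrom j T

  EvenDropsFrom-cong : ∀ {j T T′} → (∀ q → j < q → q ≤ suc n → T q ≡ T′ q) →
    EvenDropsFrom (suc j) T → EvenDropsFrom (suc j) T′
  EvenDropsFrom-cong {j} {T} {T′} same drops q j<q q≤n =
    subst₂ _≤_ (same (suc q) (NP.m≤n⇒m≤1+n j<q) (s≤s q≤n)) (same q j<q (NP.m≤n⇒m≤1+n q≤n)) (proj₁ (drops q j<q q≤n)) ,
    λ 1≤q → subst Even (cong₂ _∸_ (same q j<q (NP.m≤n⇒m≤1+n q≤n)) (same (suc q) (NP.m≤n⇒m≤1+n j<q) (s≤s q≤n)))
                        (proj₂ (drops q j<q q≤n) 1≤q)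

  EvenDropsFrom-step : ∀ {j T} → EvenDropAt j T → EvenDropsFrom (suc j) T → EvenDropsFrom j T
  EvenDropsFrom-step at-j drops q j≤q q≤n with NP.m≤n⇒m<n∨m≡n j≤q
  ... | inj₁ j<q = drops q j<q q≤n
  ... | inj₂ refl = at-j

  along-uExp′ : ∀ j q → j ≤ n → q ≤ suc n → along (uExp n π j) q ≡ 𝟙≤ q j
  along-uExp′ j q j≤n q≤ with q NP.≤? n
  ... | yes q≤n = along-uExp j q q≤n
  ... | no q≰n with NP.≤-antisym q≤ (NP.≰⇒> q≰n)
  ... | refl = trans (along-beyond (uExp n π j)) (sym (𝟙≤-no (s≤s j≤n)))

  along-uPow : ∀ t j q → j ≤ n → q ≤ suc n → along (scale t (uPow j)) q ≡ t * (uPower j * 𝟙≤ q j)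
  along-uPow t j q j≤n q≤ = trans (along-op₁ (t *_) (NP.*-zeroʳ t) _ q)
    (cong (t *_) (trans (along-op₁ (uPower j *_) (NP.*-zeroʳ (uPower j)) _ q) (cong (uPower j *_) (along-uExp′ j q j≤n q≤))))

  along-uPow-≤ : ∀ t j q → j ≤ n → q ≤ j → along (scale t (uPow j)) q ≡ t * uPower j
  along-uPow-≤ t j q j≤n q≤j = trans (along-uPow t j q j≤n (NP.≤-trans q≤j (NP.m≤n⇒m≤1+n j≤n)))
    (trans (cong (λ z → t * (uPower j * z)) (𝟙≤-yes q≤j)) (cong (t *_) (NP.*-identityʳ (uPower j))))

  along-uPow-> : ∀ t j q → j < q → q ≤ suc n → along (scale t (uPow j)) q ≡ 0
  along-uPow-> t j q j<q q≤ = trans (along-uPow t j q (NP.≤-pred (NP.<-≤-trans j<q q≤)) q≤)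
    (trans (cong (λ z → t * (uPower j * z)) (𝟙≤-no j<q)) (trans (cong (t *_) (NP.*-zeroʳ (uPower j))) (NP.*-zeroʳ t)))

  module Peel (j : ℕ) (j≤n : j ≤ n) (y b : Exp (suc n)) (t : ℕ) (tu≗b : scale t (uPow j) ≗ b) where
    A B : ℕ → ℕ
    A = along y
    B = along (y ∸ₑ b)

    c : ℕ
    c = t * uPower j

    B-low : ∀ q → q ≤ j → B q ≡ A q ∸ c
    B-low q q≤j = trans (along-∸ y b q) (cong (A q ∸_) (trans (sym (along-cong tu≗b q)) (along-uPow-≤ t j q j≤n q≤j)))

    B-high : ∀ q → j < q → q ≤ suc n → B q ≡ A q
    B-high q j<q q≤ = trans (along-∸ y b q) (cong (A q ∸_) (trans (sym (along-cong tu≗b q)) (along-uPow-> t j q j<q q≤)))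

    peel : b ≤ₑ y → Admissible (suc j) B → Admissible j A × c ≡ A j ∸ A (suc j)
    peel b≤y (flatB , dropsB) = (flatA , EvenDropsFrom-step (dropA-j , evenA-j) (EvenDropsFrom-cong (λ q j<q q≤ → B-high q j<q q≤) dropsB)) , sym drop≡c
      where
      c≤A : ∀ q → q ≤ j → c ≤ A q
      c≤A q q≤j = subst (_≤ A q) (trans (sym (along-cong tu≗b q)) (along-uPow-≤ t j q j≤n q≤j)) (along-mono b≤y q)
      flatA : FlatUpTo j A
      flatA q q≤j = NP.∸-cancelʳ-≡ (c≤A q q≤j) (c≤A 0 z≤n)
        (trans (sym (B-low q q≤j)) (trans (flatB q (NP.m≤n⇒m≤1+n q≤j)) (B-low 0 z≤n)))
      A-next : A (suc j) ≡ A j ∸ c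
      A-next = begin
        A (suc j)  ≡⟨ sym (B-high (suc j) NP.≤-refl (s≤s j≤n)) ⟩
        B (suc j)  ≡⟨ flatB (suc j) NP.≤-refl ⟩
        B 0        ≡⟨ B-low 0 z≤n ⟩
        A 0 ∸ c    ≡⟨ cong (_∸ c) (sym (flatA j NP.≤-refl)) ⟩
        A j ∸ c    ∎
        where open ≡-Reasoning
      drop≡c : A j ∸ A (suc j) ≡ c
      drop≡c = trans (cong (A j ∸_) A-next) (NP.m∸[m∸n]≡n (c≤A j NP.≤-refl))
      dropA-j : A (suc j) ≤ A j
      dropA-j = subst (_≤ A j) (sym A-next) (NP.m∸n≤m (A j) c)
      evenA-j : 1 ≤ j → Even (A j ∸ A (suc j))
      evenA-j 1≤j = subst Even (sym drop≡c) (even-at j 1≤j)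
        where
        even-at : ∀ j′ → 1 ≤ j′ → Even (t * uPower j′)
        even-at (suc _) _ = even-*2 t

    unpeel : Admissible j A → c ≡ A j ∸ A (suc j) → b ≤ₑ y × Admissible (suc j) B
    unpeel (flatA , dropsA) c≡drop = b≤y , flatB , EvenDropsFrom-cong (λ q j<q q≤ → sym (B-high q j<q q≤)) dropsA′
      where
      dropA-j : A (suc j) ≤ A j
      dropA-j = proj₁ (dropsA j NP.≤-refl j≤n)
      dropsA′ : EvenDropsFrom (suc j) A
      dropsA′ q j<q q≤n = dropsA q (NP.<⇒≤ j<q) q≤n
      b≤y : b ≤ₑ y
      b≤y = along-≤ₑ along-b≤
        where
        along-b≤ : ∀ q → q ≤ n → along b q ≤ A q
        along-b≤ q q≤n with q NP.≤? j
        ... | yes q≤j = subst₂ _≤_ (sym (trans (sym (along-cong tu≗b q)) (trans (along-uPow-≤ t j q j≤n q≤j) c≡drop)))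
                                   (trans (flatA j NP.≤-refl) (sym (flatA q q≤j))) (NP.m∸n≤m (A j) (A (suc j)))
        ... | no q≰j = subst (_≤ A q) (sym (trans (sym (along-cong tu≗b q)) (along-uPow-> t j q (NP.≰⇒> q≰j) (NP.m≤n⇒m≤1+n q≤n)))) z≤n
      B≡A-next : ∀ q → q ≤ suc j → B q ≡ A (suc j)
      B≡A-next q q≤ with NP.m≤n⇒m<n∨m≡n q≤
      ... | inj₂ refl = B-high (suc j) NP.≤-refl (s≤s j≤n)
      ... | inj₁ (s≤s q≤j) = begin
        B q                        ≡⟨ B-low q q≤j ⟩
        A q ∸ c                    ≡⟨ cong₂ _∸_ (trans (flatA q q≤j) (sym (flatA j NP.≤-refl))) c≡drop ⟩
        A j ∸ (A j ∸ A (suc j))    ≡⟨ NP.m∸[m∸n]≡n dropA-j ⟩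
        A (suc j)                  ∎
        where open ≡-Reasoning
      flatB : FlatUpTo (suc j) B
      flatB q q≤ = trans (B≡A-next q q≤) (sym (B≡A-next 0 z≤n))

  admissible-top⇒zero : ∀ y → Admissible (suc n) (along y) → zeroExp ≗ y
  admissible-top⇒zero y (flat , _) = along-≗ (λ q q≤n → trans (along-zeroExp q) (sym (along-zero q q≤n)))
    where
    along-zero : ∀ q → q ≤ n → along y q ≡ 0
    along-zero q q≤n = trans (flat q (NP.m≤n⇒m≤1+n q≤n)) (trans (sym (flat (suc n) NP.≤-refl)) (along-beyond y))

  zero⇒admissible-top : ∀ y → zeroExp ≗ y → Admissible (suc n) (along y)
  zero⇒admissible-top y 0≗y = flat , λ q n<q q≤n → ⊥-elim (NP.<⇒≱ n<q q≤n)
    where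
    flat : FlatUpTo (suc n) (along y)
    flat q _ = trans (sym (along-cong 0≗y q)) (trans (along-zeroExp q) (trans (sym (along-zeroExp 0)) (along-cong 0≗y 0)))

  top-≤ : ∀ l j → j + suc l ≡ suc n → j ≤ n
  top-≤ l j j≡ = subst (j ≤_) (NP.suc-injective (trans (sym (NP.+-suc j l)) j≡)) (NP.m≤m+n j l)

  ΠgeomU-inadmissible : ∀ l j → j + l ≡ suc n → ∀ y → ¬ Admissible j (along y) → ΠgeomU j l y ≡ 0ℤ
  ΠgeomU-inadmissible zero j j≡ y ¬adm = mono-miss {e = zeroExp} {y}
    (λ 0≗y → ¬adm (subst (λ k → Admissible k (along y)) (sym (trans (sym (NP.+-identityʳ j)) j≡)) (zero⇒admissible-top y 0≗y)))
  ΠgeomU-inadmissible (suc l) j j≡ y ¬adm = geom-⊛-zero (uPow j) (ΠgeomU (suc j) l) y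
    (λ b t b≤y tu≗b → ΠgeomU-inadmissible l (suc j) j≡′ (y ∸ₑ b) (¬adm ∘ proj₁ ∘ Peel.peel j (top-≤ l j j≡) y b t tu≗b b≤y))
    where
    j≡′ : suc j + l ≡ suc n
    j≡′ = trans (sym (NP.+-suc j l)) j≡

  ΠgeomU-admissible : ∀ l j → j + l ≡ suc n → ∀ y → Admissible j (along y) → ΠgeomU j l y ≡ 1ℤ
  ΠgeomU-admissible zero j j≡ y adm = mono-hit {e = zeroExp} {y}
    (admissible-top⇒zero y (subst (λ k → Admissible k (along y)) (trans (sym (NP.+-identityʳ j)) j≡) adm))
  ΠgeomU-admissible (suc l) j j≡ y adm = trans
    (geom-⊛-single (uPow j) zero (uPower j ∸ 1) (uPower-nonzero j) (ΠgeomU (suc j) l) (ΠL-ext (map geomU (range (suc j) l)))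
       y K (proj₁ step) other-multiples)
    (ΠgeomU-admissible l (suc j) j≡′ (y ∸ₑ scale K (uPow j)) (proj₂ step))
    where
    j≡′ : suc j + l ≡ suc n
    j≡′ = trans (sym (NP.+-suc j l)) j≡
    j≤n : j ≤ n
    j≤n = top-≤ l j j≡
    uPower-nonzero : ∀ j → uPow j zero ≡ suc (uPower j ∸ 1)
    uPower-nonzero zero = refl
    uPower-nonzero (suc j) = refl
    quotient = divide-by-uPower j (along y j ∸ along y (suc j)) (proj₂ (proj₂ adm j NP.≤-refl j≤n))
    K = proj₁ quotient
    step = Peel.unpeel j j≤n y (scale K (uPow j)) K (λ _ → refl) adm (proj₂ quotient)
    other-multiples : ∀ b t → b ≤ₑ y → scale t (uPow j) ≗ b → t ≢ K → ΠgeomU (suc j) l (y ∸ₑ b) ≡ 0ℤ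
    other-multiples b t b≤y tu≗b t≢K = ΠgeomU-inadmissible l (suc j) j≡′ (y ∸ₑ b) (λ adm′ →
      t≢K (uPower-cancel j t K (trans (proj₂ (Peel.peel j j≤n y b t tu≗b b≤y adm′)) (sym (proj₂ quotient)))))

termWith : (n : ℕ) → List ℕ → List ℕ → List ℕ → PS (suc n)
termWith n π D S =
  mono (sumExp (map (uExp n π) D))
  ⊛ mono (sumExp (map (uExp n π) S))
  ⊛ geom (unit zero)
  ⊛ ΠL (map (λ j → geom (scale 2 (uExp n π j))) (map suc (upTo n)))

map-applyUpTo : ∀ (f g : ℕ → ℕ) l → map f (applyUpTo g l) ≡ applyUpTo (f ∘ g) l
map-applyUpTo f g zero = refl
map-applyUpTo f g (suc l) = cong (f (g 0) ∷_) (map-applyUpTo f (g ∘ suc) l)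

applyUpTo-range : ∀ l k (g : ℕ → ℕ) → (∀ t → g t ≡ k + t) → applyUpTo g l ≡ range k l
applyUpTo-range zero k g h = refl
applyUpTo-range (suc l) k g h =
  cong₂ _∷_ (trans (h 0) (NP.+-identityʳ k)) (applyUpTo-range l (suc k) (g ∘ suc) (λ t → trans (h (suc t)) (NP.+-suc k t)))

geom-cong : ∀ {m} {e e′ : Exp m} → e ≗ e′ → ∀ y → geom e y ≡ geom e′ y
geom-cong {e = e} {e′} h y = sum-cong (upTo (suc (deg y))) (λ k → cong indicator (eqExp-iff {e = scale k e} {y} {scale k e′} {y}
  (λ q i → trans (cong (k *_) (sym (h i))) (q i)) (λ q i → trans (cong (k *_) (h i)) (q i))))

module TermCoefficient (n : ℕ) (π : List ℕ) (P : IsPerm n π) where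
  open GeomProduct n π P

  shiftExp : List ℕ → List ℕ → Exp (suc n)
  shiftExp D S = addExp (sumExp (map (uExp n π) D)) (sumExp (map (uExp n π) S))

  denominator-factors : map (λ j → geom (scale 2 (uExp n π j))) (map suc (upTo n)) ≡ map geomU (range 1 n)
  denominator-factors = trans (cong (map _) (trans (map-applyUpTo suc id n) (applyUpTo-range n 1 suc (λ t → refl))))
                              (LP.map-cong-local (range-positive 0 n))
    where
    range-positive : ∀ k l → All (λ j → geom (scale 2 (uExp n π j)) ≡ geomU j) (range (suc k) l)
    range-positive k zero = []
    range-positive k (suc l) = refl ∷ range-positive (suc k) l

  z₀≗uPow₀ : unit zero ≗ uPow 0
  z₀≗uPow₀ zero = refl
  z₀≗uPow₀ (suc i) = refl

  term-coefficient : ∀ D S a → termWith n π D S a ≡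
    (if leExp (shiftExp D S) a then ΠgeomU 0 (suc n) (a ∸ₑ shiftExp D S) else 0ℤ)
  term-coefficient D S a = trans
    (⊛-congˡ (ΠL (map (λ j → geom (scale 2 (uExp n π j))) (map suc (upTo n))))
       (λ b → trans (⊛-congˡ (geom (unit zero)) (mono-⊛-mono (sumExp (map (uExp n π) D)) (sumExp (map (uExp n π) S))) b)
                    (⊛-congʳ (mono (shiftExp D S)) (geom-cong z₀≗uPow₀) b)) a)
    (trans (⊛-congʳ (mono (shiftExp D S) ⊛ geomU 0) (λ b → cong (λ l → ΠL l b) denominator-factors) a)
       (mono-⊛-⊛ (shiftExp D S) (geomU 0) (ΠgeomU 1 n) a (geom-ext _) (ΠL-ext (map geomU (range 1 n)))))

DropsExceed : ℕ → (A δ : ℕ → ℕ) → Set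
DropsExceed n A δ = ∀ q → q ≤ n → A (suc q) + δ q ≤ A q × (1 ≤ q → Even (A q ∸ A (suc q) ∸ δ q))

-- With G q = Σ_{t ≥ q} δ t, the condition that A − G be admissible (as in
-- GeomProduct) is equivalent to DropsExceed.
module DifferenceConditions (n : ℕ) (A G δ : ℕ → ℕ) (G-step : ∀ q → G q ≡ δ q + G (suc q))
                            (A-top : A (suc n) ≡ 0) (G-top : G (suc n) ≡ 0) where

  DifferenceAdmissible : Set
  DifferenceAdmissible = (∀ q → q ≤ n → G q ≤ A q) ×
    (∀ q → q ≤ n → (A (suc q) ∸ G (suc q)) ≤ (A q ∸ G q) × (1 ≤ q → Even ((A q ∸ G q) ∸ (A (suc q) ∸ G (suc q)))))

  shuffle : ∀ x d g → g + x + d ≡ d + g + x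
  shuffle = solve-∀

  module Position (q : ℕ) (G≤A-next : G (suc q) ≤ A (suc q)) (G≤A : G q ≤ A q) where
    x y d g : ℕ
    x = A (suc q) ∸ G (suc q)
    y = A q ∸ G q
    d = δ q
    g = G (suc q)

    A-next≡ : A (suc q) + d ≡ d + g + x
    A-next≡ = trans (cong (_+ d) (sym (NP.m+[n∸m]≡n G≤A-next))) (shuffle x d g)

    A≡ : A q ≡ d + g + y
    A≡ = trans (sym (NP.m+[n∸m]≡n G≤A)) (cong (_+ y) (G-step q))

    drop-≤ : x ≤ y → A (suc q) + d ≤ A q
    drop-≤ x≤y = subst₂ _≤_ (sym A-next≡) (sym A≡) (NP.+-monoʳ-≤ (d + g) x≤y)

    ≤-drop : A (suc q) + d ≤ A q → x ≤ y
    ≤-drop le = NP.+-cancelˡ-≤ (d + g) x y (subst₂ _≤_ A-next≡ A≡ le)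

    excess≡ : A q ∸ A (suc q) ∸ d ≡ y ∸ x
    excess≡ = begin
      A q ∸ A (suc q) ∸ d        ≡⟨ NP.∸-+-assoc (A q) (A (suc q)) d ⟩
      A q ∸ (A (suc q) + d)      ≡⟨ cong₂ _∸_ A≡ A-next≡ ⟩
      (d + g + y) ∸ (d + g + x)  ≡⟨ NP.[m+n]∸[m+o]≡n∸o (d + g) y x ⟩
      y ∸ x                      ∎
      where open ≡-Reasoning

  G≤A-next : ∀ q → q ≤ n → (∀ q → q ≤ n → G q ≤ A q) → G (suc q) ≤ A (suc q)
  G≤A-next q q≤n G≤A with NP.m≤n⇒m<n∨m≡n q≤n
  ... | inj₁ q<n = G≤A (suc q) q<n
  ... | inj₂ refl = subst (_≤ A (suc n)) (sym G-top) z≤n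

  admissible⇒dropsExceed : DifferenceAdmissible → DropsExceed n A δ
  admissible⇒dropsExceed (G≤A , drops) q q≤n =
    drop-≤ (proj₁ (drops q q≤n)) , λ 1≤q → subst Even (sym excess≡) (proj₂ (drops q q≤n) 1≤q)
    where open Position q (G≤A-next q q≤n G≤A) (G≤A q q≤n)

  dropsExceed⇒admissible : DropsExceed n A δ → DifferenceAdmissible
  dropsExceed⇒admissible drops = G≤A , λ q q≤n → let open Position q (G≤A-next q q≤n G≤A) (G≤A q q≤n) in
    ≤-drop (proj₁ (drops q q≤n)) , λ 1≤q → subst Even excess≡ (proj₂ (drops q q≤n) 1≤q)
    where
    G≤A-from-top : ∀ k q → q + k ≡ suc n → G q ≤ A q
    G≤A-from-top zero q q≡ = subst (λ z → G z ≤ A z) (sym (trans (sym (NP.+-identityʳ q)) q≡)) (subst (_≤ A (suc n)) (sym G-top) z≤n)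
    G≤A-from-top (suc k) q q≡ = begin
      G q                ≡⟨ G-step q ⟩
      δ q + G (suc q)    ≤⟨ NP.+-monoʳ-≤ (δ q) (G≤A-from-top k (suc q) (trans (sym (NP.+-suc q k)) q≡)) ⟩
      δ q + A (suc q)    ≡⟨ NP.+-comm (δ q) (A (suc q)) ⟩
      A (suc q) + δ q    ≤⟨ proj₁ (drops q q≤n) ⟩
      A q                ∎
      where
      open NP.≤-Reasoning
      q≤n : q ≤ n
      q≤n = subst (q ≤_) (NP.suc-injective (trans (sym (NP.+-suc q k)) q≡)) (NP.m≤m+n q k)
    G≤A : ∀ q → q ≤ n → G q ≤ A q
    G≤A q q≤n = G≤A-from-top (suc n ∸ q) q (NP.m+[n∸m]≡n (NP.m≤n⇒m≤1+n q≤n))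

𝟙≡ : ℕ → ℕ → ℕ
𝟙≡ q j = if q ≡ᵇ j then 1 else 0

count : ℕ → List ℕ → ℕ
count q [] = 0
count q (j ∷ L) = 𝟙≡ q j + count q L

countAtLeast : List ℕ → ℕ → ℕ
countAtLeast [] q = 0
countAtLeast (j ∷ L) q = 𝟙≤ q j + countAtLeast L q

𝟙≤-split : ∀ q j → 𝟙≤ q j ≡ 𝟙≡ q j + 𝟙≤ (suc q) j
𝟙≤-split zero zero = refl
𝟙≤-split zero (suc j) = refl
𝟙≤-split (suc q) zero = refl
𝟙≤-split (suc q) (suc j) = trans (𝟙≤-suc q j) (trans (𝟙≤-split q j) (cong (𝟙≡ q j +_) (sym (𝟙≤-suc (suc q) j))))
  where
  𝟙≤-suc : ∀ q j → 𝟙≤ (suc q) (suc j) ≡ 𝟙≤ q j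
  𝟙≤-suc q j = cong (λ b → if b then 1 else 0) (≤ᵇ-suc q j)

countAtLeast-split : ∀ L q → countAtLeast L q ≡ count q L + countAtLeast L (suc q)
countAtLeast-split [] q = refl
countAtLeast-split (j ∷ L) q rewrite 𝟙≤-split q j | countAtLeast-split L q =
  +-interchange (𝟙≡ q j) (𝟙≤ (suc q) j) (count q L) (countAtLeast L (suc q))

countAtLeast-beyond : ∀ n L → (∀ j → j ∈ L → j ≤ n) → countAtLeast L (suc n) ≡ 0
countAtLeast-beyond n [] h = refl
countAtLeast-beyond n (j ∷ L) h = cong₂ _+_ (𝟙≤-no (s≤s (h j (here refl)))) (countAtLeast-beyond n L (λ j′ p → h j′ (there p)))

module ShiftedTerm (n : ℕ) (π : List ℕ) (P : IsPerm n π) (D S : List ℕ)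
                   (D≤n : ∀ j → j ∈ D → j ≤ n) (S≤n : ∀ j → j ∈ S → j ≤ n) where
  open AlongPermutation n π P
  open GeomProduct n π P
  open TermCoefficient n π P

  E : Exp (suc n)
  E = shiftExp D S

  G δ : ℕ → ℕ
  G q = countAtLeast D q + countAtLeast S q
  δ q = count q D + count q S

  G-step : ∀ q → G q ≡ δ q + G (suc q)
  G-step q rewrite countAtLeast-split D q | countAtLeast-split S q =
    +-interchange (count q D) (countAtLeast D (suc q)) (count q S) (countAtLeast S (suc q))

  along-sumExp : ∀ L q → q ≤ n → along (sumExp (map (uExp n π) L)) q ≡ countAtLeast L q
  along-sumExp [] q q≤n = along-zeroExp q
  along-sumExp (j ∷ L) q q≤n = trans (along-op _+_ refl (uExp n π j) (sumExp (map (uExp n π) L)) q)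
    (cong₂ _+_ (along-uExp j q q≤n) (along-sumExp L q q≤n))

  along-E : ∀ q → q ≤ suc n → along E q ≡ G q
  along-E q q≤ with NP.m≤n⇒m<n∨m≡n q≤
  ... | inj₁ (s≤s q≤n) = trans (along-op _+_ refl _ _ q) (cong₂ _+_ (along-sumExp D q q≤n) (along-sumExp S q q≤n))
  ... | inj₂ refl = trans (along-beyond E) (sym (cong₂ _+_ (countAtLeast-beyond n D D≤n) (countAtLeast-beyond n S S≤n)))

  module _ (a : Exp (suc n)) where
    open DifferenceConditions n (along a) G δ G-step (along-beyond a) (trans (sym (along-E (suc n) NP.≤-refl)) (along-beyond E))

    along-a∸E : ∀ q → q ≤ suc n → along (a ∸ₑ E) q ≡ along a q ∸ G q
    along-a∸E q q≤ = trans (along-∸ a E q) (cong (along a q ∸_) (along-E q q≤))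

    drop-a∸E : ∀ q → q ≤ n → EvenDropAt q (along (a ∸ₑ E)) ⇔ EvenDropAt q (λ r → along a r ∸ G r)
    drop-a∸E q q≤n = mk⇔
      (λ (le , ev) → subst₂ _≤_ (along-a∸E (suc q) (s≤s q≤n)) (along-a∸E q (NP.m≤n⇒m≤1+n q≤n)) le ,
                      λ 1≤q → subst Even (cong₂ _∸_ (along-a∸E q (NP.m≤n⇒m≤1+n q≤n)) (along-a∸E (suc q) (s≤s q≤n))) (ev 1≤q))
      (λ (le , ev) → subst₂ _≤_ (sym (along-a∸E (suc q) (s≤s q≤n))) (sym (along-a∸E q (NP.m≤n⇒m≤1+n q≤n))) le ,
                      λ 1≤q → subst Even (sym (cong₂ _∸_ (along-a∸E q (NP.m≤n⇒m≤1+n q≤n)) (along-a∸E (suc q) (s≤s q≤n)))) (ev 1≤q))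

    toDifference : E ≤ₑ a → Admissible 0 (along (a ∸ₑ E)) → DifferenceAdmissible
    toDifference E≤a (_ , drops) =
      (λ q q≤n → subst (_≤ along a q) (along-E q (NP.m≤n⇒m≤1+n q≤n)) (along-mono E≤a q)) ,
      (λ q q≤n → Equivalence.to (drop-a∸E q q≤n) (drops q z≤n q≤n))

    fromDifference : DifferenceAdmissible → E ≤ₑ a × Admissible 0 (along (a ∸ₑ E))
    fromDifference (G≤A , drops) =
      along-≤ₑ (λ q q≤n → subst (_≤ along a q) (sym (along-E q (NP.m≤n⇒m≤1+n q≤n))) (G≤A q q≤n)) ,
      (λ { zero _ → refl }) , (λ q _ q≤n → Equivalence.from (drop-a∸E q q≤n) (drops q q≤n))

    term-one : DropsExceed n (along a) δ → termWith n π D S a ≡ 1ℤ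
    term-one drops = trans (term-coefficient D S a) (trans
      (cong (λ b → if b then ΠgeomU 0 (suc n) (a ∸ₑ E) else 0ℤ) (leExp-complete (proj₁ fromD)))
      (ΠgeomU-admissible (suc n) 0 refl (a ∸ₑ E) (proj₂ fromD)))
      where fromD = fromDifference (dropsExceed⇒admissible drops)

    term-zero : ¬ DropsExceed n (along a) δ → termWith n π D S a ≡ 0ℤ
    term-zero ¬drops = trans (term-coefficient D S a) (case (leExp E a) refl)
      where
      case : ∀ b → leExp E a ≡ b → (if b then ΠgeomU 0 (suc n) (a ∸ₑ E) else 0ℤ) ≡ 0ℤ
      case false _ = refl
      case true E≤a = ΠgeomU-inadmissible (suc n) 0 refl (a ∸ₑ E)
        (λ adm → ¬drops (admissible⇒dropsExceed (toDifference (leExp-sound E≤a) adm)))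

parity : ℕ → ℕ
parity zero = 0
parity (suc zero) = 1
parity (suc (suc r)) = parity r

parity≤1 : ∀ r → parity r ≤ 1
parity≤1 zero = z≤n
parity≤1 (suc zero) = NP.≤-refl
parity≤1 (suc (suc r)) = parity≤1 r

even-suc-suc : ∀ {r} → Even r → Even (suc (suc r))
even-suc-suc (K , e) = suc K , cong suc (trans (cong suc e) (sym (NP.+-suc K K)))

even-pred-pred : ∀ {r} → Even (suc (suc r)) → Even r
even-pred-pred (zero , ())
even-pred-pred (suc K , e) = K , NP.suc-injective (trans (NP.suc-injective e) (NP.+-suc K K))

¬even-1 : ¬ Even 1
¬even-1 (zero , ())
¬even-1 (suc K , e) with trans (NP.suc-injective e) (NP.+-suc K K)
... | ()

parity-0⇒even : ∀ r → parity r ≡ 0 → Even r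
parity-0⇒even zero _ = 0 , refl
parity-0⇒even (suc (suc r)) h = even-suc-suc (parity-0⇒even r h)

parity-1⇒odd : ∀ r → parity r ≡ 1 → 1 ≤ r × Even (r ∸ 1)
parity-1⇒odd (suc zero) _ = s≤s z≤n , (0 , refl)
parity-1⇒odd (suc (suc r)) h with parity-1⇒odd r h
... | s≤s _ , even = s≤s z≤n , even-suc-suc even

even⇒parity-0 : ∀ r → Even r → parity r ≡ 0
even⇒parity-0 zero _ = refl
even⇒parity-0 (suc zero) even = ⊥-elim (¬even-1 even)
even⇒parity-0 (suc (suc r)) even = even⇒parity-0 r (even-pred-pred even)

odd⇒parity-1 : ∀ r → 1 ≤ r → Even (r ∸ 1) → parity r ≡ 1
odd⇒parity-1 (suc zero) _ _ = refl
odd⇒parity-1 (suc (suc zero)) _ even = ⊥-elim (¬even-1 even)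
odd⇒parity-1 (suc (suc (suc r))) _ even = odd⇒parity-1 (suc r) (s≤s z≤n) (even-pred-pred even)

≤1-cases : ∀ {e} → e ≤ 1 → e ≡ 0 ⊎ e ≡ 1
≤1-cases z≤n = inj₁ refl
≤1-cases (s≤s z≤n) = inj₂ refl

-- When the second contribution cS is 0/1-valued, "A drops by at least cD + cS
-- with even excess" splits into a condition on cD alone (A 1 ≤ A 0 and Sorted)
-- which determines cS uniquely as a parity (Match).
module Decomposition (n : ℕ) (A cD cS : ℕ → ℕ) (cD0 : cD 0 ≡ 0) (cS0 : cS 0 ≡ 0) (cS≤1 : ∀ q → cS q ≤ 1) where

  Sorted : Set
  Sorted = ∀ q → 1 ≤ q → q ≤ n → A (suc q) + cD q ≤ A q

  excess : ℕ → ℕ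
  excess q = A q ∸ A (suc q) ∸ cD q

  Match : Set
  Match = ∀ q → 1 ≤ q → q ≤ n → cS q ≡ parity (excess q)

  excess-split : ∀ q → A q ∸ A (suc q) ∸ (cD q + cS q) ≡ excess q ∸ cS q
  excess-split q = sym (NP.∸-+-assoc (A q ∸ A (suc q)) (cD q) (cS q))

  A-next+0 : A 1 + (cD 0 + cS 0) ≡ A 1
  A-next+0 = trans (cong (A 1 +_) (cong₂ _+_ cD0 cS0)) (NP.+-identityʳ (A 1))

  dropsExceed⇒head : DropsExceed n A (λ q → cD q + cS q) → A 1 ≤ A 0
  dropsExceed⇒head drops = subst (_≤ A 0) A-next+0 (proj₁ (drops 0 z≤n))

  dropsExceed⇒sorted : DropsExceed n A (λ q → cD q + cS q) → Sorted
  dropsExceed⇒sorted drops q _ q≤n = NP.≤-trans (NP.m≤m+n (A (suc q) + cD q) (cS q))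
    (subst (_≤ A q) (sym (NP.+-assoc (A (suc q)) (cD q) (cS q))) (proj₁ (drops q q≤n)))

  cS≤excess : ∀ q → A (suc q) + (cD q + cS q) ≤ A q → cS q ≤ excess q
  cS≤excess q le = begin
    cS q                                  ≡⟨ sym (NP.m+n∸m≡n (A (suc q) + cD q) (cS q)) ⟩
    (A (suc q) + cD q + cS q) ∸ (A (suc q) + cD q)
      ≤⟨ NP.∸-monoˡ-≤ (A (suc q) + cD q) (subst (_≤ A q) (sym (NP.+-assoc (A (suc q)) (cD q) (cS q))) le) ⟩
    A q ∸ (A (suc q) + cD q)              ≡⟨ sym (NP.∸-+-assoc (A q) (A (suc q)) (cD q)) ⟩
    excess q                              ∎
    where open NP.≤-Reasoning

  dropsExceed⇒match : DropsExceed n A (λ q → cD q + cS q) → Match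
  dropsExceed⇒match drops q 1≤q q≤n with ≤1-cases (cS≤1 q) | drops q q≤n
  ... | inj₁ cS≡0 | _ , even = trans cS≡0 (sym (even⇒parity-0 _
    (subst Even (trans (excess-split q) (cong (excess q ∸_) cS≡0)) (even 1≤q))))
  ... | inj₂ cS≡1 | le , even = trans cS≡1 (sym (odd⇒parity-1 _ (subst (_≤ excess q) cS≡1 (cS≤excess q le))
    (subst Even (trans (excess-split q) (cong (excess q ∸_) cS≡1)) (even 1≤q))))

  head+sorted+match⇒dropsExceed : A 1 ≤ A 0 → Sorted → Match → DropsExceed n A (λ q → cD q + cS q)
  head+sorted+match⇒dropsExceed A₁≤A₀ sorted match zero _ = subst (_≤ A 0) (sym A-next+0) A₁≤A₀ , λ ()
  head+sorted+match⇒dropsExceed A₁≤A₀ sorted match q@(suc _) q≤n with ≤1-cases (cS≤1 q)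
  ... | inj₁ cS≡0 =
    subst (_≤ A q) (sym (trans (cong (λ z → A (suc q) + (cD q + z)) cS≡0) (cong (A (suc q) +_) (NP.+-identityʳ (cD q)))))
      (sorted q (s≤s z≤n) q≤n) ,
    λ _ → subst Even (sym (trans (excess-split q) (cong (excess q ∸_) cS≡0)))
                     (parity-0⇒even _ (trans (sym (match q (s≤s z≤n) q≤n)) cS≡0))
  ... | inj₂ cS≡1 = subst (λ z → A (suc q) + (cD q + z) ≤ A q) (sym cS≡1) drop-by-one ,
    λ _ → subst Even (sym (trans (excess-split q) (cong (excess q ∸_) cS≡1))) (proj₂ odd)
    where
    odd = parity-1⇒odd (excess q) (trans (sym (match q (s≤s z≤n) q≤n)) cS≡1)
    drop-by-one : A (suc q) + (cD q + 1) ≤ A q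
    drop-by-one = begin
      A (suc q) + (cD q + 1)              ≡⟨ sym (NP.+-assoc (A (suc q)) (cD q) 1) ⟩
      A (suc q) + cD q + 1                ≤⟨ NP.+-monoʳ-≤ (A (suc q) + cD q) (proj₁ odd) ⟩
      A (suc q) + cD q + excess q         ≡⟨ cong (A (suc q) + cD q +_) (NP.∸-+-assoc (A q) (A (suc q)) (cD q)) ⟩
      A (suc q) + cD q + (A q ∸ (A (suc q) + cD q))  ≡⟨ NP.m+[n∸m]≡n (sorted q (s≤s z≤n) q≤n) ⟩
      A q                                 ∎
      where open NP.≤-Reasoning

∈-concatMap : ∀ {A B : Set} (f : A → List B) {x : A} {y : B} xs → x ∈ xs → y ∈ f x → y ∈ concatMap f xs
∈-concatMap f xs x∈ y∈ = ∈-concatMap⁺ f (lose x∈ y∈)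

concatMap-∈ : ∀ {A B : Set} (f : A → List B) {y : B} xs → y ∈ concatMap f xs → ∃ λ x → x ∈ xs × y ∈ f x
concatMap-∈ f xs y∈ = find (∈-concatMap⁻ f {xs} y∈)

ins-mem : ∀ x π ys → ys ∈ ins x π → ∀ v → v ∈ ys → v ≡ x ⊎ v ∈ π
ins-mem x [] ys (here refl) v (here e) = inj₁ e
ins-mem x (y ∷ π) ys (here refl) v (here e) = inj₁ e
ins-mem x (y ∷ π) ys (here refl) v (there q) = inj₂ q
ins-mem x (y ∷ π) ys (there p) v q with ∈-map⁻ (y ∷_) p
... | zs , zp , refl with q
... | here e = inj₂ (here e)
... | there q′ with ins-mem x π zs zp v q′
... | inj₁ e = inj₁ e
... | inj₂ r = inj₂ (there r)

mem-ins : ∀ x π ys → ys ∈ ins x π → ∀ v → v ≡ x ⊎ v ∈ π → v ∈ ys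
mem-ins x [] ys (here refl) v (inj₁ e) = here e
mem-ins x (y ∷ π) ys (here refl) v (inj₁ e) = here e
mem-ins x (y ∷ π) ys (here refl) v (inj₂ q) = there q
mem-ins x (y ∷ π) ys (there p) v h with ∈-map⁻ (y ∷_) p
... | zs , zp , refl with h
... | inj₁ e = there (mem-ins x π zs zp v (inj₁ e))
... | inj₂ (here e) = here e
... | inj₂ (there q) = there (mem-ins x π zs zp v (inj₂ q))

ins-length : ∀ x π ys → ys ∈ ins x π → length ys ≡ suc (length π)
ins-length x [] ys (here refl) = refl
ins-length x (y ∷ π) ys (here refl) = refl
ins-length x (y ∷ π) ys (there p) with ∈-map⁻ (y ∷_) p
... | zs , zp , refl = cong suc (ins-length x π zs zp)

ins-distinct : ∀ x π ys → ys ∈ ins x π → Distinct π → ¬ (x ∈ π) → Distinct ys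
ins-distinct x [] ys (here refl) d x∉ = (λ ()) ∷ []
ins-distinct x (y ∷ π) ys (here refl) d x∉ = x∉ ∷ d
ins-distinct x (y ∷ π) ys (there p) (y∉ ∷ d) x∉ with ∈-map⁻ (y ∷_) p
... | zs , zp , refl = (λ q → y∉zs (ins-mem x π zs zp y q)) ∷ ins-distinct x π zs zp d (x∉ ∘ there)
  where
  y∉zs : y ≡ x ⊎ y ∈ π → ⊥
  y∉zs (inj₁ e) = x∉ (here (sym e))
  y∉zs (inj₂ q) = y∉ q

perms-isPerm : ∀ n π → π ∈ perms n → IsPerm n π
perms-isPerm zero π (here refl) = record { len = refl ; dist = [] ; rng = λ v () ; cov = λ v 1≤v v≤0 → ⊥-elim (NP.<⇒≱ 1≤v v≤0) }
perms-isPerm (suc n) ys p with concatMap-∈ (ins (suc n)) (perms n) p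
... | π , π∈ , ys∈ = record
  { len = trans (ins-length (suc n) π ys ys∈) (cong suc (IsPerm.len Pπ))
  ; dist = ins-distinct (suc n) π ys ys∈ (IsPerm.dist Pπ) (λ q → NP.<⇒≱ (s≤s (proj₂ (IsPerm.rng Pπ (suc n) q))) NP.≤-refl)
  ; rng = λ v q → range-ins v (ins-mem (suc n) π ys ys∈ v q)
  ; cov = λ v 1≤v v≤ → mem-ins (suc n) π ys ys∈ v (cover-ins v 1≤v v≤)
  }
  where
  Pπ = perms-isPerm n π π∈
  range-ins : ∀ v → v ≡ suc n ⊎ v ∈ π → 1 ≤ v × v ≤ suc n
  range-ins v (inj₁ refl) = s≤s z≤n , NP.≤-refl
  range-ins v (inj₂ q) = proj₁ (IsPerm.rng Pπ v q) , NP.m≤n⇒m≤1+n (proj₂ (IsPerm.rng Pπ v q))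
  cover-ins : ∀ v → 1 ≤ v → v ≤ suc n → v ≡ suc n ⊎ v ∈ π
  cover-ins v 1≤v v≤ with NP.m≤n⇒m<n∨m≡n v≤
  ... | inj₂ e = inj₁ e
  ... | inj₁ (s≤s v≤n) = inj₂ (IsPerm.cov Pπ v 1≤v v≤n)

Chain : (ℕ → ℕ → Bool) → List ℕ → Bool
Chain lt (x ∷ y ∷ r) = lt x y ∧ Chain lt (y ∷ r)
Chain lt _ = true

-- For a strict total order lt, a chain can only arise by inserting into a
-- chain, and a chain admits exactly one insertion position that keeps it a chain;
-- so exactly one element of perms m is a chain.
module InsertionSort (lt : ℕ → ℕ → Bool) (N : ℕ)
  (lt-trans : ∀ x y z → lt x y ≡ true → lt y z ≡ true → lt x z ≡ true)
  (lt-asym : ∀ x y → x ≢ y → lt x y ≡ true → lt y x ≡ false)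
  (lt-total : ∀ x y → 1 ≤ x → x ≤ N → 1 ≤ y → y ≤ N → x ≢ y → lt x y ≡ true ⊎ lt y x ≡ true) where

  chain-tail : ∀ x r → Chain lt (x ∷ r) ≡ true → Chain lt r ≡ true
  chain-tail x [] h = refl
  chain-tail x (y ∷ r) h = ∧-true₂ {lt x y} h

  chain-head : ∀ y zs c → Chain lt (y ∷ zs) ≡ true → c ∈ zs → lt y c ≡ true
  chain-head y (z ∷ zs) c h (here refl) = ∧-true₁ h
  chain-head y (z ∷ zs) c h (there p) = lt-trans y z c (∧-true₁ h) (chain-head z zs c (∧-true₂ {lt y z} h) p)

  chain-cons-false : ∀ y zs → Chain lt zs ≡ false → Chain lt (y ∷ zs) ≡ false
  chain-cons-false y [] ()
  chain-cons-false y (z ∷ zs) h with lt y z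
  ... | true = h
  ... | false = refl

  removal-cons : ∀ c y r zs → zs ∈ ins c r → Chain lt r ≡ true → Chain lt (y ∷ zs) ≡ true → Chain lt (y ∷ r) ≡ true
  removal-cons c y [] zs zs∈ chain-r h = refl
  removal-cons c y (z ∷ r) zs (here refl) chain-r h = ∧-intro (lt-trans y c z (∧-true₁ h) (∧-true₁ (∧-true₂ {lt y c} h))) chain-r
  removal-cons c y (z ∷ r) zs (there p) chain-r h with ∈-map⁻ (z ∷_) p
  ... | _ , _ , refl = ∧-intro (∧-true₁ h) chain-r

  removal : ∀ c π ys → ys ∈ ins c π → Chain lt ys ≡ true → Chain lt π ≡ true
  removal c [] ys p h = refl
  removal c (y ∷ r) ys (here refl) h = ∧-true₂ {lt c y} h
  removal c (y ∷ r) ys (there p) h with ∈-map⁻ (y ∷_) p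
  ... | zs , zs∈ , refl = removal-cons c y r zs zs∈ (removal c r zs zs∈ (chain-tail y zs h)) h

  record Insertion (c : ℕ) (π : List ℕ) : Set where
    field
      result : List ℕ
      result∈ : result ∈ ins c π
      chain : Chain lt result ≡ true
      chain-cons : ∀ y → lt y c ≡ true → Chain lt (y ∷ π) ≡ true → Chain lt (y ∷ result) ≡ true
      sum-single : ∀ (f : List ℕ → ℤ) → (∀ zs → zs ∈ ins c π → Chain lt zs ≡ false → f zs ≡ 0ℤ) →
                   sumℤ (map f (ins c π)) ≡ f result

  insertion : ∀ c π → 1 ≤ c → c ≤ N → (∀ v → v ∈ π → 1 ≤ v × v ≤ N) → ¬ (c ∈ π) → Chain lt π ≡ true → Insertion c π
  insertion c [] 1≤c c≤N _ _ _ = record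
    { result = c ∷ [] ; result∈ = here refl ; chain = refl
    ; chain-cons = λ y h _ → ∧-intro h refl ; sum-single = λ f _ → ZP.+-identityʳ (f (c ∷ [])) }
  insertion c (y ∷ r) 1≤c c≤N rng c∉ chain-π
    with lt-total c y 1≤c c≤N (proj₁ (rng y (here refl))) (proj₂ (rng y (here refl))) (c∉ ∘ here)
  ... | inj₁ c<y = record
    { result = c ∷ y ∷ r ; result∈ = here refl ; chain = ∧-intro c<y chain-π
    ; chain-cons = λ _ h _ → ∧-intro h (∧-intro c<y chain-π)
    ; sum-single = λ f vanish → trans (cong (f (c ∷ y ∷ r) +ℤ_) (trans (sum-map-map f (y ∷_) (ins c r))
        (sum-zero-∈ (ins c r) (λ zs zs∈ → vanish (y ∷ zs) (there (∈-map⁺ (y ∷_) zs∈))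
          (≢true⇒≡false (λ h → true≢false (chain-head y zs c h (mem-ins c r zs zs∈ c (inj₁ refl))) (lt-asym c y (c∉ ∘ here) c<y)))))))
        (ZP.+-identityʳ (f (c ∷ y ∷ r))) }
  ... | inj₂ y<c = record
    { result = y ∷ I.result ; result∈ = there (∈-map⁺ (y ∷_) I.result∈) ; chain = I.chain-cons y y<c chain-π
    ; chain-cons = λ _ h chain′ → ∧-intro (∧-true₁ chain′) (I.chain-cons y y<c chain-π)
    ; sum-single = λ f vanish → trans (cong (_+ℤ sumℤ (map f (map (y ∷_) (ins c r))))
        (vanish (c ∷ y ∷ r) (here refl) (cong (_∧ Chain lt (y ∷ r)) (lt-asym y c (λ e → c∉ (here (sym e))) y<c))))
        (trans (ZP.+-identityˡ (sumℤ (map f (map (y ∷_) (ins c r))))) (trans (sum-map-map f (y ∷_) (ins c r))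
          (I.sum-single (f ∘ (y ∷_)) (λ zs zs∈ ¬chain → vanish (y ∷ zs) (there (∈-map⁺ (y ∷_) zs∈)) (chain-cons-false y zs ¬chain))))) }
    where
    module I = Insertion (insertion c r 1≤c c≤N (λ v p → rng v (there p)) (c∉ ∘ there) (chain-tail y r chain-π))

  record SortedPermutation (m : ℕ) : Set where
    field
      π* : List ℕ
      π*∈ : π* ∈ perms m
      chain : Chain lt π* ≡ true
      sum-single : ∀ (f : List ℕ → ℤ) → (∀ π → π ∈ perms m → Chain lt π ≡ false → f π ≡ 0ℤ) →
                   sumℤ (map f (perms m)) ≡ f π*

  sortedPermutation : ∀ m → m ≤ N → SortedPermutation m
  sortedPermutation zero _ = record { π* = [] ; π*∈ = here refl ; chain = refl ; sum-single = λ f _ → ZP.+-identityʳ (f []) }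
  sortedPermutation (suc m) m<N = record
    { π* = I.result
    ; π*∈ = ∈-concatMap (ins (suc m)) (perms m) S.π*∈ I.result∈
    ; chain = I.chain
    ; sum-single = λ f vanish → trans (sum-concatMap f (ins (suc m)) (perms m)) (trans
        (S.sum-single (λ π → sumℤ (map f (ins (suc m) π))) (λ π π∈ ¬chain → sum-zero-∈ (ins (suc m) π) (λ zs zs∈ →
          vanish zs (∈-concatMap (ins (suc m)) (perms m) π∈ zs∈) (≢true⇒≡false (λ h → true≢false (removal (suc m) π zs zs∈ h) ¬chain)))))
        (I.sum-single f (λ zs zs∈ ¬chain → vanish zs (∈-concatMap (ins (suc m)) (perms m) S.π*∈ zs∈) ¬chain)))
    }
    where
    module S = SortedPermutation (sortedPermutation m (NP.<⇒≤ m<N))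
    P = perms-isPerm m S.π* S.π*∈
    module I = Insertion (insertion (suc m) S.π* (s≤s z≤n) m<N
      (λ v p → proj₁ (IsPerm.rng P v p) , NP.≤-trans (proj₂ (IsPerm.rng P v p)) (NP.<⇒≤ m<N))
      (λ p → NP.<⇒≱ (s≤s (proj₂ (IsPerm.rng P (suc m) p))) NP.≤-refl) S.chain)

toℕᵇ : Bool → ℕ
toℕᵇ b = if b then 1 else 0

toℕᵇ≤1 : ∀ b → toℕᵇ b ≤ 1
toℕᵇ≤1 true = NP.≤-refl
toℕᵇ≤1 false = z≤n

toℕᵇ-<ᵇ-yes : ∀ {y x} → y < x → toℕᵇ (y <ᵇ x) ≡ 1
toℕᵇ-<ᵇ-yes h rewrite <ᵇ-complete h = refl

toℕᵇ-<ᵇ-no : ∀ {y x} → ¬ y < x → toℕᵇ (y <ᵇ x) ≡ 0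
toℕᵇ-<ᵇ-no h rewrite <ᵇ-false h = refl

count-++ : ∀ q l r → count q (l ++ r) ≡ count q l + count q r
count-++ q [] r = refl
count-++ q (x ∷ l) r = trans (cong (𝟙≡ q x +_) (count-++ q l r)) (sym (NP.+-assoc (𝟙≡ q x) (count q l) (count q r)))

𝟙≡-self : ∀ q → 𝟙≡ q q ≡ 1
𝟙≡-self q rewrite ≡ᵇ-refl q = refl

𝟙≡-other : ∀ {q j} → q ≢ j → 𝟙≡ q j ≡ 0
𝟙≡-other ne rewrite ≡ᵇ-false ne = refl

count-∉ : ∀ q l → ¬ (q ∈ l) → count q l ≡ 0
count-∉ q [] _ = refl
count-∉ q (x ∷ l) q∉ = cong₂ _+_ (𝟙≡-other (q∉ ∘ here)) (count-∉ q l (q∉ ∘ there))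

desAux-range : ∀ j l v → v ∈ desAux j l → j ≤ v × v < j + length l
desAux-range j (x ∷ y ∷ r) v p = split (∈-++⁻ (if y <ᵇ x then j ∷ [] else []) p) (desAux-range (suc j) (y ∷ r) v)
  where
  single : ∀ b → v ∈ (if b then j ∷ [] else []) → j ≤ v × v < j + length (x ∷ y ∷ r)
  single true (here refl) = NP.≤-refl , NP.m<m+n j (s≤s z≤n)
  split : v ∈ (if y <ᵇ x then j ∷ [] else []) ⊎ v ∈ desAux (suc j) (y ∷ r) →
          (v ∈ desAux (suc j) (y ∷ r) → suc j ≤ v × v < suc j + length (y ∷ r)) → j ≤ v × v < j + length (x ∷ y ∷ r)
  split (inj₁ q) _ = single (y <ᵇ x) q
  split (inj₂ q) ih = NP.<⇒≤ (proj₁ (ih q)) , subst (v <_) (sym (NP.+-suc j (length (y ∷ r)))) (proj₂ (ih q))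

-- Positions are counted from 0 here, whereas Des counts from 1.
descentAt : List ℕ → ℕ → ℕ
descentAt (x ∷ y ∷ r) zero = toℕᵇ (y <ᵇ x)
descentAt (x ∷ y ∷ r) (suc p) = descentAt (y ∷ r) p
descentAt _ _ = 0

count-desAux : ∀ j l p → count (j + p) (desAux j l) ≡ descentAt l p
count-desAux j [] p = refl
count-desAux j (x ∷ []) p = refl
count-desAux j (x ∷ y ∷ r) p = trans (count-++ (j + p) (if y <ᵇ x then j ∷ [] else []) (desAux (suc j) (y ∷ r))) (at p)
  where
  here-count : ∀ p → count (j + p) (if y <ᵇ x then j ∷ [] else []) ≡ toℕᵇ (y <ᵇ x) * 𝟙≡ (j + p) j
  here-count p with y <ᵇ x
  ... | true = trans (NP.+-identityʳ _) (sym (NP.*-identityˡ _))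
  ... | false = refl
  at : ∀ p → count (j + p) (if y <ᵇ x then j ∷ [] else []) + count (j + p) (desAux (suc j) (y ∷ r)) ≡ descentAt (x ∷ y ∷ r) p
  at zero = trans (cong₂ _+_
    (trans (here-count 0) (trans (cong (λ z → toℕᵇ (y <ᵇ x) * 𝟙≡ z j) (NP.+-identityʳ j))
                                 (trans (cong (toℕᵇ (y <ᵇ x) *_) (𝟙≡-self j)) (NP.*-identityʳ _))))
    (count-∉ (j + 0) (desAux (suc j) (y ∷ r))
      (λ p → NP.<⇒≱ (subst (_< suc j) (sym (NP.+-identityʳ j)) NP.≤-refl) (proj₁ (desAux-range (suc j) (y ∷ r) (j + 0) p)))))
    (NP.+-identityʳ _)
  at (suc p) = trans (cong₂ _+_
    (trans (here-count (suc p)) (trans (cong (toℕᵇ (y <ᵇ x) *_) (𝟙≡-other (λ e → NP.<⇒≢ (NP.m<m+n j (s≤s z≤n)) (sym e))))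
                                       (NP.*-zeroʳ (toℕᵇ (y <ᵇ x)))))
    (cong (λ z → count z (desAux (suc j) (y ∷ r))) (NP.+-suc j p)))
    (count-desAux (suc j) (y ∷ r) p)

descentAt-inside : ∀ l p → suc p < length l → descentAt l p ≡ toℕᵇ (nth l (suc p) <ᵇ nth l p)
descentAt-inside (x ∷ []) zero (s≤s ())
descentAt-inside (x ∷ y ∷ r) zero _ = refl
descentAt-inside (x ∷ y ∷ r) (suc p) (s≤s lt) = descentAt-inside (y ∷ r) p lt

descentAt-outside : ∀ l p → length l ≤ suc p → descentAt l p ≡ 0
descentAt-outside [] p _ = refl
descentAt-outside (x ∷ []) p _ = refl
descentAt-outside (x ∷ y ∷ r) (suc p) (s≤s le) = descentAt-outside (y ∷ r) p le

chain-nth : ∀ lt l → Chain lt l ≡ true → ∀ p → suc p < length l → lt (nth l p) (nth l (suc p)) ≡ true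
chain-nth lt (x ∷ []) h zero (s≤s ())
chain-nth lt (x ∷ y ∷ r) h zero _ = ∧-true₁ h
chain-nth lt (x ∷ y ∷ r) h (suc p) (s≤s p<) = chain-nth lt (y ∷ r) (∧-true₂ {lt x y} h) p p<

nth-chain : ∀ lt l → (∀ p → suc p < length l → lt (nth l p) (nth l (suc p)) ≡ true) → Chain lt l ≡ true
nth-chain lt [] h = refl
nth-chain lt (x ∷ []) h = refl
nth-chain lt (x ∷ y ∷ r) h = ∧-intro (h 0 (s≤s (s≤s z≤n))) (nth-chain lt (y ∷ r) (λ p p< → h (suc p) (s≤s p<)))

-- x comes before y when V x > V y, or V x = V y and x < y: sorting by
-- decreasing V with ties broken increasingly, whose descents are exactly the
-- positions where V drops strictly.
before : (ℕ → ℕ) → ℕ → ℕ → Bool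
before V x y = (V y + toℕᵇ (y <ᵇ x)) ≤ᵇ V x

module BeforeOrder (V : ℕ → ℕ) where

  before-trans : ∀ x y z → before V x y ≡ true → before V y z ≡ true → before V x z ≡ true
  before-trans x y z x<y y<z = ≤ᵇ-complete (goal (z <? x))
    where
    h₁ = ≤ᵇ-sound x<y
    h₂ = ≤ᵇ-sound y<z
    Vy≤Vx : V y ≤ V x
    Vy≤Vx = NP.≤-trans (NP.m≤m+n (V y) _) h₁
    goal : Dec (z < x) → V z + toℕᵇ (z <ᵇ x) ≤ V x
    goal (no z≮x) rewrite toℕᵇ-<ᵇ-no z≮x =
      NP.≤-trans (NP.≤-reflexive (NP.+-identityʳ (V z))) (NP.≤-trans (NP.m≤m+n (V z) _) (NP.≤-trans h₂ Vy≤Vx))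
    goal (yes z<x) with z <? y
    ... | yes z<y rewrite toℕᵇ-<ᵇ-yes z<x = NP.≤-trans (subst (_≤ V y) (cong (V z +_) (toℕᵇ-<ᵇ-yes z<y)) h₂) Vy≤Vx
    ... | no z≮y rewrite toℕᵇ-<ᵇ-yes z<x =
      NP.≤-trans (NP.+-monoˡ-≤ 1 (subst (_≤ V y) (trans (cong (V z +_) (toℕᵇ-<ᵇ-no z≮y)) (NP.+-identityʳ (V z))) h₂))
                 (subst (_≤ V x) (cong (V y +_) (toℕᵇ-<ᵇ-yes (NP.≤-<-trans (NP.≮⇒≥ z≮y) z<x))) h₁)

  before-asym : ∀ x y → x ≢ y → before V x y ≡ true → before V y x ≡ false
  before-asym x y x≢y x<y = ≢true⇒≡false (λ y<x → contra (≤ᵇ-sound y<x) (NP.<-cmp x y))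
    where
    h = ≤ᵇ-sound x<y
    contra : V x + toℕᵇ (x <ᵇ y) ≤ V y → _ → ⊥
    contra k (tri< x<y′ _ _) = NP.<⇒≱ (subst (_≤ V y) (trans (cong (V x +_) (toℕᵇ-<ᵇ-yes x<y′)) (NP.+-comm (V x) 1)) k)
                                     (subst (_≤ V x) (trans (cong (V y +_) (toℕᵇ-<ᵇ-no (NP.<⇒≯ x<y′))) (NP.+-identityʳ (V y))) h)
    contra k (tri≈ _ e _) = x≢y e
    contra k (tri> _ _ y<x′) = NP.<⇒≱ (subst (_≤ V x) (trans (cong (V y +_) (toℕᵇ-<ᵇ-yes y<x′)) (NP.+-comm (V y) 1)) h)
                                     (subst (_≤ V y) (trans (cong (V x +_) (toℕᵇ-<ᵇ-no (NP.<⇒≯ y<x′))) (NP.+-identityʳ (V x))) k)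

  before-total : ∀ x y → x ≢ y → before V x y ≡ true ⊎ before V y x ≡ true
  before-total x y x≢y with NP.<-cmp (V x) (V y)
  ... | tri< Vx<Vy _ _ = inj₂ (≤ᵇ-complete (NP.≤-trans (NP.+-monoʳ-≤ (V x) (toℕᵇ≤1 _)) (subst (_≤ V y) (NP.+-comm 1 (V x)) Vx<Vy)))
  ... | tri> _ _ Vy<Vx = inj₁ (≤ᵇ-complete (NP.≤-trans (NP.+-monoʳ-≤ (V y) (toℕᵇ≤1 _)) (subst (_≤ V x) (NP.+-comm 1 (V y)) Vy<Vx)))
  ... | tri≈ _ Vx≡Vy _ with NP.<-cmp x y
  ...   | tri< x<y _ _ = inj₁ (≤ᵇ-complete (NP.≤-reflexive (trans (cong (V y +_) (toℕᵇ-<ᵇ-no (NP.<⇒≯ x<y)))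
                                                              (trans (NP.+-identityʳ (V y)) (sym Vx≡Vy)))))
  ...   | tri≈ _ e _ = ⊥-elim (x≢y e)
  ...   | tri> _ _ y<x = inj₂ (≤ᵇ-complete (NP.≤-reflexive (trans (cong (V x +_) (toℕᵇ-<ᵇ-no (NP.<⇒≯ y<x)))
                                                              (trans (NP.+-identityʳ (V x)) Vx≡Vy))))

module SortedAlong (n : ℕ) (π : List ℕ) (P : IsPerm n π) (a : Exp (suc n)) where
  open AlongPermutation n π P
  open IsPerm P

  cD : ℕ → ℕ
  cD q = count q (Des π)

  V : ℕ → ℕ
  V = exponentOf a

  Sorted : Set
  Sorted = ∀ q → 1 ≤ q → q ≤ n → along a (suc q) + cD q ≤ along a q

  cD≡descentAt : ∀ p → cD (suc p) ≡ descentAt π p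
  cD≡descentAt p = count-desAux 1 π p

  sorted⇒chain : Sorted → Chain (before V) π ≡ true
  sorted⇒chain sorted = nth-chain (before V) π (λ p p< → ≤ᵇ-complete
    (subst (λ z → V (nth π (suc p)) + z ≤ V (nth π p)) (trans (cD≡descentAt p) (descentAt-inside π p p<))
      (sorted (suc p) (s≤s z≤n) (subst (suc p ≤_) len (NP.<⇒≤ p<)))))

  chain⇒sorted : Chain (before V) π ≡ true → Sorted
  chain⇒sorted h (suc p) _ _ with suc p <? length π
  ... | yes p< = subst (λ z → V (nth π (suc p)) + z ≤ V (nth π p)) (sym (trans (cD≡descentAt p) (descentAt-inside π p p<)))
                       (≤ᵇ-sound (chain-nth (before V) π h p p<))
  ... | no p≮ = subst (_≤ V (nth π p))
    (sym (cong₂ _+_ (cong V (nth-beyond π (suc p) (NP.≮⇒≥ p≮))) (trans (cD≡descentAt p) (descentAt-outside π p (NP.≮⇒≥ p≮))))) z≤n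

  cD0 : cD 0 ≡ 0
  cD0 = count-∉ 0 (Des π) (λ p → NP.<⇒≱ (s≤s z≤n) (proj₁ (desAux-range 1 π 0 p)))

  Des≤n : ∀ j → j ∈ Des π → j ≤ n
  Des≤n j p = NP.≤-pred (subst (j <_) (cong suc len) (proj₂ (desAux-range 1 π j p)))

  sorted⇒≤first : Sorted → ∀ p → p < n → along a (suc p) ≤ along a 1
  sorted⇒≤first sorted zero _ = NP.≤-refl
  sorted⇒≤first sorted (suc p) p< =
    NP.≤-trans (NP.≤-trans (NP.m≤m+n _ _) (sorted (suc p) (s≤s z≤n) (NP.<⇒≤ p<))) (sorted⇒≤first sorted p (NP.<⇒≤ p<))

NNeg-⊆ : ∀ ε ρ v → v ∈ NNeg (zip ε ρ) → v ∈ ρ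
NNeg-⊆ (true ∷ ε) (x ∷ ρ) v (here e) = here e
NNeg-⊆ (true ∷ ε) (x ∷ ρ) v (there p) = there (NNeg-⊆ ε ρ v p)
NNeg-⊆ (false ∷ ε) (x ∷ ρ) v p = there (NNeg-⊆ ε ρ v p)

count-NNeg≤1 : ∀ ε ρ → Distinct ρ → ∀ q → count q (NNeg (zip ε ρ)) ≤ 1
count-NNeg≤1 [] ρ d q = z≤n
count-NNeg≤1 (e ∷ ε) [] d q = z≤n
count-NNeg≤1 (false ∷ ε) (x ∷ ρ) (x∉ ∷ d) q = count-NNeg≤1 ε ρ d q
count-NNeg≤1 (true ∷ ε) (x ∷ ρ) (x∉ ∷ d) q with q ≡ᵇ x in eq
... | true = NP.≤-reflexive (cong suc (count-∉ q (NNeg (zip ε ρ)) (λ p → x∉ (subst (_∈ ρ) (≡ᵇ-sound eq) (NNeg-⊆ ε ρ q p)))))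
... | false = count-NNeg≤1 ε ρ d q

-- true encodes the sign -1.
signOf : (ℕ → ℕ) → ℕ → Bool
signOf β v = β v ≡ᵇ 1

signOf-false : ∀ β v → β v ≤ 1 → signOf β v ≡ false → β v ≡ 0
signOf-false β v β≤1 h with β v
... | zero = refl
... | suc zero = ⊥-elim (true≢false (≡ᵇ-refl 1) h)
... | suc (suc k) = ⊥-elim (NP.<⇒≱ (s≤s (s≤s z≤n)) β≤1)

count-NNeg-signOf : ∀ (β : ℕ → ℕ) → (∀ q → β q ≤ 1) → ∀ ρ → Distinct ρ → ∀ v → v ∈ ρ →
  count v (NNeg (zip (map (signOf β) ρ) ρ)) ≡ β v
count-NNeg-signOf β β≤1 (x ∷ ρ) (x∉ ∷ d) v p with signOf β x in eq
count-NNeg-signOf β β≤1 (x ∷ ρ) (x∉ ∷ d) v (here refl) | true rewrite ≡ᵇ-refl x =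
  trans (cong suc (count-∉ x (NNeg (zip (map (signOf β) ρ) ρ)) (x∉ ∘ NNeg-⊆ (map (signOf β) ρ) ρ x))) (sym (≡ᵇ-sound eq))
count-NNeg-signOf β β≤1 (x ∷ ρ) (x∉ ∷ d) v (there p) | true rewrite ≡ᵇ-false {v} {x} (λ e → x∉ (subst (_∈ ρ) e p)) =
  count-NNeg-signOf β β≤1 ρ d v p
count-NNeg-signOf β β≤1 (x ∷ ρ) (x∉ ∷ d) v (here refl) | false =
  trans (count-∉ x (NNeg (zip (map (signOf β) ρ) ρ)) (x∉ ∘ NNeg-⊆ (map (signOf β) ρ) ρ x)) (sym (signOf-false β x (β≤1 x) eq))
count-NNeg-signOf β β≤1 (x ∷ ρ) (x∉ ∷ d) v (there p) | false = count-NNeg-signOf β β≤1 ρ d v p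

signOf-unique : ∀ (β : ℕ → ℕ) ε ρ → Distinct ρ → length ε ≡ length ρ →
  (∀ v → v ∈ ρ → count v (NNeg (zip ε ρ)) ≡ β v) → ε ≡ map (signOf β) ρ
signOf-unique β [] [] d _ h = refl
signOf-unique β (e ∷ ε) (x ∷ ρ) (x∉ ∷ d) len h =
  cong₂ _∷_ (head e (h x (here refl))) (signOf-unique β ε ρ d (NP.suc-injective len) (λ v p → trans (tail-count e v p) (h v (there p))))
  where
  rest0 : count x (NNeg (zip ε ρ)) ≡ 0
  rest0 = count-∉ x (NNeg (zip ε ρ)) (x∉ ∘ NNeg-⊆ ε ρ x)
  head : ∀ e → count x (NNeg (zip (e ∷ ε) (x ∷ ρ))) ≡ β x → e ≡ signOf β x
  head true hx rewrite ≡ᵇ-refl x | sym hx | rest0 = refl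
  head false hx rewrite sym hx | rest0 = refl
  tail-count : ∀ e v → v ∈ ρ → count v (NNeg (zip ε ρ)) ≡ count v (NNeg (zip (e ∷ ε) (x ∷ ρ)))
  tail-count true v p rewrite ≡ᵇ-false {v} {x} (λ e → x∉ (subst (_∈ ρ) e p)) = refl
  tail-count false v p = refl

sum-signs-single : ∀ n (g : List Bool → ℤ) ε* → length ε* ≡ n → (∀ ε → length ε ≡ n → ε ≢ ε* → g ε ≡ 0ℤ) →
  sumℤ (map g (signs n)) ≡ g ε*
sum-signs-single zero g [] _ h = ZP.+-identityʳ (g [])
sum-signs-single (suc n) g (b ∷ ε′) len h = trans (sum-concatMap g (λ s → (true ∷ s) ∷ (false ∷ s) ∷ []) (signs n))
  (trans (sum-signs-single n both ε′ (NP.suc-injective len)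
     (λ s s-len ne → cong₂ _+ℤ_ (h (true ∷ s) (cong suc s-len) (λ e → ne (LP.∷-injectiveʳ e)))
                                (cong (_+ℤ 0ℤ) (h (false ∷ s) (cong suc s-len) (λ e → ne (LP.∷-injectiveʳ e))))))
    (pick b h))
  where
  both : List Bool → ℤ
  both s = sumℤ (map g ((true ∷ s) ∷ (false ∷ s) ∷ []))
  pick : ∀ b → (∀ ε → length ε ≡ suc n → ε ≢ (b ∷ ε′) → g ε ≡ 0ℤ) → both ε′ ≡ g (b ∷ ε′)
  pick true h′ = trans (cong (g (true ∷ ε′) +ℤ_) (trans (ZP.+-identityʳ (g (false ∷ ε′))) (h′ (false ∷ ε′) len (λ ())))) (ZP.+-identityʳ _)
  pick false h′ = trans (cong₂ _+ℤ_ (h′ (true ∷ ε′) len (λ ())) (ZP.+-identityʳ (g (false ∷ ε′)))) (ZP.+-identityˡ _)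

keyBefore : ℕ → (ℕ → ℕ) → ℕ → ℕ → Bool
keyBefore n β x y = key n (signOf β x , x) <ᵇ key n (signOf β y , y)

increasing-signOf : ∀ n β ρ → increasing n (zip (map (signOf β) ρ) ρ) ≡ Chain (keyBefore n β) ρ
increasing-signOf n β [] = refl
increasing-signOf n β (x ∷ []) = refl
increasing-signOf n β (x ∷ y ∷ r) = cong (keyBefore n β x y ∧_) (increasing-signOf n β (y ∷ r))

key-injective : ∀ n b b′ x y → 1 ≤ x → x ≤ n → 1 ≤ y → y ≤ n → key n (b , x) ≡ key n (b′ , y) → x ≡ y
key-injective n true true x y _ _ _ _ e = e
key-injective n false false x y _ _ _ _ e = NP.+-cancelˡ-≡ n x y e
key-injective n true false x y _ x≤n 1≤y _ e = ⊥-elim (NP.<⇒≱ (NP.≤-<-trans x≤n (NP.m<m+n n 1≤y)) (NP.≤-reflexive (sym e)))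
key-injective n false true x y 1≤x _ _ y≤n e = ⊥-elim (NP.<⇒≱ (NP.≤-<-trans y≤n (NP.m<m+n n 1≤x)) (NP.≤-reflexive e))

module KeyOrder (n : ℕ) (β : ℕ → ℕ) where
  κ : ℕ → ℕ
  κ x = key n (signOf β x , x)

  key-trans : ∀ x y z → keyBefore n β x y ≡ true → keyBefore n β y z ≡ true → keyBefore n β x z ≡ true
  key-trans x y z h₁ h₂ = <ᵇ-complete (NP.<-trans (<ᵇ-sound {κ x} {κ y} h₁) (<ᵇ-sound {κ y} {κ z} h₂))

  key-asym : ∀ x y → x ≢ y → keyBefore n β x y ≡ true → keyBefore n β y x ≡ false
  key-asym x y _ h = <ᵇ-false {κ y} {κ x} (NP.<⇒≯ (<ᵇ-sound {κ x} {κ y} h))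

  key-total : ∀ x y → 1 ≤ x → x ≤ n → 1 ≤ y → y ≤ n → x ≢ y → keyBefore n β x y ≡ true ⊎ keyBefore n β y x ≡ true
  key-total x y 1≤x x≤n 1≤y y≤n x≢y with NP.<-cmp (κ x) (κ y)
  ... | tri< lt _ _ = inj₁ (<ᵇ-complete lt)
  ... | tri≈ _ e _ = ⊥-elim (x≢y (key-injective n (signOf β x) (signOf β y) x y 1≤x x≤n 1≤y y≤n e))
  ... | tri> _ _ gt = inj₂ (<ᵇ-complete gt)

I2-unfold : ∀ n (F : SignedPerm → ℤ) → sumℤ (map F (I2 n)) ≡
  sumℤ (map (λ ρ → sumℤ (map (λ ε → if increasing n (zip ε ρ) then F (zip ε ρ) else 0ℤ) (signs n))) (perms n))
I2-unfold n F = trans (sum-filter (increasing n) F (signedPerms n))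
  (trans (sum-concatMap _ (λ ρ → map (λ ε → zip ε ρ) (signs n)) (perms n))
    (sum-cong (perms n) (λ ρ → sum-map-map _ (λ ε → zip ε ρ) (signs n))))

NNegMatches : ℕ → (ℕ → ℕ) → SignedPerm → Set
NNegMatches n β w = ∀ q → 1 ≤ q → q ≤ n → count q (NNeg w) ≡ β q

-- For each ρ only the signs signOf β can match β, and (signOf β, ρ) lies in
-- I_{2,n} exactly when ρ is increasing for keyBefore, which singles out one ρ.
sum-I2-single : ∀ n (β : ℕ → ℕ) → (∀ q → β q ≤ 1) → (F : SignedPerm → ℤ) →
  (∀ ε ρ → IsPerm n ρ → length ε ≡ n → NNegMatches n β (zip ε ρ) → F (zip ε ρ) ≡ 1ℤ) →
  (∀ ε ρ → IsPerm n ρ → length ε ≡ n → ¬ NNegMatches n β (zip ε ρ) → F (zip ε ρ) ≡ 0ℤ) →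
  sumℤ (map F (I2 n)) ≡ 1ℤ
sum-I2-single n β β≤1 F F-match F-mismatch = begin
  sumℤ (map F (I2 n))
    ≡⟨ I2-unfold n F ⟩
  sumℤ (map over-signs (perms n))
    ≡⟨ S.sum-single over-signs (λ ρ ρ∈ ¬chain → trans (over-signs≡ ρ (perms-isPerm n ρ ρ∈)) (cong indicator ¬chain)) ⟩
  over-signs S.π*
    ≡⟨ over-signs≡ S.π* (perms-isPerm n S.π* S.π*∈) ⟩
  indicator (Chain (keyBefore n β) S.π*)
    ≡⟨ cong indicator S.chain ⟩
  1ℤ ∎
  where
  open ≡-Reasoning
  open KeyOrder n β
  module IS = InsertionSort (keyBefore n β) n key-trans key-asym key-total
  module S = IS.SortedPermutation (IS.sortedPermutation n NP.≤-refl)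
  over-signs : List ℕ → ℤ
  over-signs ρ = sumℤ (map (λ ε → if increasing n (zip ε ρ) then F (zip ε ρ) else 0ℤ) (signs n))
  over-signs≡ : ∀ ρ → IsPerm n ρ → over-signs ρ ≡ indicator (Chain (keyBefore n β) ρ)
  over-signs≡ ρ Pρ = trans
    (sum-signs-single n _ (map (signOf β) ρ) signs-len (λ ε len ε≢ → if-zero (increasing n (zip ε ρ))
      (F-mismatch ε ρ Pρ len (λ match → ε≢ (signOf-unique β ε ρ (IsPerm.dist Pρ) (trans len (sym (IsPerm.len Pρ)))
        (λ v v∈ → match v (proj₁ (IsPerm.rng Pρ v v∈)) (proj₂ (IsPerm.rng Pρ v v∈))))))))
    (trans (cong (λ z → if increasing n (zip (map (signOf β) ρ) ρ) then z else 0ℤ)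
             (F-match (map (signOf β) ρ) ρ Pρ signs-len
               (λ q 1≤q q≤n → count-NNeg-signOf β β≤1 ρ (IsPerm.dist Pρ) q (IsPerm.cov Pρ q 1≤q q≤n))))
           (cong indicator (increasing-signOf n β ρ)))
    where
    signs-len : length (map (signOf β) ρ) ≡ n
    signs-len = trans (LP.length-map (signOf β) ρ) (IsPerm.len Pρ)

module Coefficient (n : ℕ) (a : Exp (suc n)) where

  V : ℕ → ℕ
  V = exponentOf a

  termSum : List ℕ → ℤ
  termSum π = sumℤ (map (λ w → term n π w a) (I2 n))

  RHS-unfold : RHS n a ≡ sumℤ (map termSum (perms n))
  RHS-unfold = trans (ΣL-eval (concatMap (λ π → map (term n π) (I2 n)) (perms n)) a)
    (trans (sum-concatMap (λ f → f a) (λ π → map (term n π) (I2 n)) (perms n))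
      (sum-cong (perms n) (λ π → sum-map-map (λ f → f a) (term n π) (I2 n))))

  module ForPermutation (π : List ℕ) (P : IsPerm n π) where
    open AlongPermutation n π P
    open SortedAlong n π P a hiding (V)

    module Signed (ε : List Bool) (ρ : List ℕ) (Pρ : IsPerm n ρ) where
      NNeg≤n : ∀ j → j ∈ NNeg (zip ε ρ) → j ≤ n
      NNeg≤n j p = proj₂ (IsPerm.rng Pρ j (NNeg-⊆ ε ρ j p))

      count-NNeg-0 : count 0 (NNeg (zip ε ρ)) ≡ 0
      count-NNeg-0 = count-∉ 0 (NNeg (zip ε ρ)) (λ p → NP.<⇒≱ (proj₁ (IsPerm.rng Pρ 0 (NNeg-⊆ ε ρ 0 p))) z≤n)

      open Decomposition n (along a) cD (λ q → count q (NNeg (zip ε ρ))) cD0 count-NNeg-0 (count-NNeg≤1 ε ρ (IsPerm.dist Pρ)) public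
      open ShiftedTerm n π P (Des π) (NNeg (zip ε ρ)) Des≤n NNeg≤n public using (term-one; term-zero)

    termSum-sorted : along a 1 ≤ along a 0 → Chain (before V) π ≡ true → termSum π ≡ 1ℤ
    termSum-sorted A₁≤A₀ chain = sum-I2-single n (λ q → parity (along a q ∸ along a (suc q) ∸ cD q))
      (λ q → parity≤1 (along a q ∸ along a (suc q) ∸ cD q)) (λ w → term n π w a)
      (λ ε ρ Pρ _ match → Signed.term-one ε ρ Pρ a (Signed.head+sorted+match⇒dropsExceed ε ρ Pρ A₁≤A₀ (chain⇒sorted chain) match))
      (λ ε ρ Pρ _ ¬match → Signed.term-zero ε ρ Pρ a (¬match ∘ Signed.dropsExceed⇒match ε ρ Pρ))

    termSum-unsorted : ¬ (along a 1 ≤ along a 0 × Chain (before V) π ≡ true) → termSum π ≡ 0ℤ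
    termSum-unsorted ¬sorted = trans (I2-unfold n (λ w → term n π w a))
      (sum-zero-∈ (perms n) (λ ρ ρ∈ → sum-zero (signs n) (λ ε → if-zero (increasing n (zip ε ρ))
        (Signed.term-zero ε ρ (perms-isPerm n ρ ρ∈) a (λ drops → ¬sorted
          (Signed.dropsExceed⇒head ε ρ (perms-isPerm n ρ ρ∈) drops ,
           sorted⇒chain (Signed.dropsExceed⇒sorted ε ρ (perms-isPerm n ρ ρ∈) drops)))))))

  module IS = InsertionSort (before V) n (BeforeOrder.before-trans V) (BeforeOrder.before-asym V)
                            (λ x y _ _ _ _ → BeforeOrder.before-total V x y)
  open IS.SortedPermutation (IS.sortedPermutation n NP.≤-refl)

  P* : IsPerm n π*
  P* = perms-isPerm n π* π*∈

  open AlongPermutation n π* P*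
  open SortedAlong n π* P* a using (chain⇒sorted; sorted⇒≤first)

  RHS≡termSum-π* : RHS n a ≡ termSum π*
  RHS≡termSum-π* = trans RHS-unfold (sum-single termSum (λ π π∈ ¬chain →
    ForPermutation.termSum-unsorted π (perms-isPerm n π π∈) (λ h → true≢false (proj₂ h) ¬chain)))

  LHS≡termSum-π* : 1 ≤ n → LHS n a ≡ termSum π*
  LHS≡termSum-π* 1≤n with along a 1 ≤? along a 0
  ... | yes A₁≤A₀ = trans (LHS-dominant n a dominant) (sym (ForPermutation.termSum-sorted π* P* A₁≤A₀ chain))
    where
    dominant : ∀ j → a (suc j) ≤ a zero
    dominant j with locate j
    ... | p , p<n , e = NP.≤-trans (NP.≤-reflexive (sym (along-exponentOf a j p e)))
                                   (NP.≤-trans (sorted⇒≤first (chain⇒sorted chain) p p<n) A₁≤A₀)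
  ... | no A₁≰A₀ with variableAt 0 1≤n
  ... | j , e = trans (LHS-not-dominant n a j (subst (a zero <_) (along-exponentOf a j 0 e) (NP.≰⇒> A₁≰A₀)))
                      (sym (ForPermutation.termSum-unsorted π* P* (A₁≰A₀ ∘ proj₁)))

corollary6p3 : (n : ℕ) → 1 ≤ n → (a : Exp (suc n)) → LHS n a ≡ RHS n a
corollary6p3 n 1≤n a = trans (LHS≡termSum-π* 1≤n) (sym RHS≡termSum-π*)
  where open Coefficient n a
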